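{- Let $q$ be a prime power and $k\ge 2$ an integer. Let $v\equiv 1\pmod{k(k-1)}$ be a prime. Assume that $\frac{[v-1]_q}{[k]_q[k-1]_q}=uv$ for some integer $u$ and that $q\not\equiv 1\pmod v$. If $\mathcal{I}$ is a set of $u$ projective subspaces of dimension $k-1$ of $\mathrm{PG}(\mathbb{F}_q^v)$ such that $\Delta\mathcal{I}$ is evenly distributed over the $\frac{[v]_q-1}{v}$ orbits of $\mathrm{Frob}([\mathbb{Z}_v]_q)$ on $[\mathbb{Z}_v]_q^*$, then $\mathcal{I}$ is a collection of initial base blocks of a $(v,k,1)_q$ difference family, i.e., the family $(B^\alpha)_{B\in\mathcal{I},\,\alpha\in\mathrm{Frob}([\mathbb{Z}_v]_q)}$ is a $(v,k,1)_q$ difference family.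
   Context: $[n]_q=\frac{q^n-1}{q-1}$. The Singer group $[\mathbb{Z}_v]_q=\mathbb{F}_{q^v}^*/\mathbb{F}_q^*$ is cyclic of order $[v]_q$; its elements are identified with the points of $\mathrm{PG}(\mathbb{F}_q^v)$; $[\mathbb{Z}_v]_q^*$ is the set of non-identity elements. $\mathrm{Frob}([\mathbb{Z}_v]_q)=\{\phi^i:0\le i\le v-1\}$ with $\phi(x)=x^q$. For a set $B$ of points, $\Delta B$ is the multiset of $xy^{ -1}$ over ordered pairs $(x,y)$ of distinct elements of $B$; $\Delta\mathcal{I}$ is the multiset union; $B^\alpha=\{\alpha(b):b\in B\}$. Evenly distributed: each orbit contains the same number of elements of $\Delta\mathcal{I}$, with multiplicity. A $(v,k,1)_q$ difference family is a collection of $(k-1)$-dimensional projective subspaces of $\mathrm{PG}(\mathbb{F}_q^v)$ whose list of differences contains every element of $[\mathbb{Z}_v]_q^*$ exactly once. -}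

module Defs where

open import Level using (_⊔_)
open import Algebra.Bundles using (CommutativeRing)
open import Data.Nat as ℕ using (ℕ; zero; suc)
open import Data.Product using (_×_; _,_; ∃; proj₁; proj₂)
open import Data.List using (List; []; _∷_; length; filter; map; concatMap; cartesianProduct; upTo)
open import Data.Nat.ListAction using (sum)
open import Data.List.Relation.Unary.Any using (Any; any?)
open import Data.List.Relation.Unary.All using (All)
open import Data.List.Relation.Unary.AllPairs using (AllPairs)
open import Data.Vec as Vec using (Vec)
import Data.Vec.Relation.Unary.All as VecAll
open import Relation.Binary using (Decidable)
open import Relation.Binary.PropositionalEquality using (_≡_)
open import Relation.Nullary using (¬_; Dec)
open import Relation.Nullary.Decidable using (¬?; _×-dec_)

-- Gaussian number [n]_q = 1 + q + ... + q^(n-1) = (q^n - 1)/(q - 1)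
[_]_ : ℕ → ℕ → ℕ
[ zero ] q = 0
[ suc n ] q = 1 ℕ.+ q ℕ.* ([ n ] q)

allTuples : ∀ {a} {A : Set a} → List A → (k : ℕ) → List (Vec A k)
allTuples xs zero = Vec.[] ∷ []
allTuples xs (suc k) = concatMap (λ x → map (x Vec.∷_) (allTuples xs k)) xs

-- Everything below lives inside a commutative ring R (with decidable
-- equality) which will be assumed to be the finite field F_{q^v}.
module FF {c ℓ} (R : CommutativeRing c ℓ) (_≟_ : Decidable (CommutativeRing._≈_ R)) where
  open CommutativeRing R

  IsField : Set (c ⊔ ℓ)
  IsField = (¬ (0# ≈ 1#)) × (∀ x → ¬ (x ≈ 0#) → ∃ λ y → x * y ≈ 1#)

  FiniteEnumeration : List Carrier → ℕ → Set (c ⊔ ℓ)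
  FiniteEnumeration elems n =
    (∀ x → Any (x ≈_) elems) × AllPairs (λ a b → ¬ (a ≈ b)) elems × length elems ≡ n

  pow : Carrier → ℕ → Carrier
  pow x zero = 1#
  pow x (suc n) = x * pow x n

  lincomb : ∀ {k} → Vec Carrier k → Vec Carrier k → Carrier
  lincomb cs bs = Vec.foldr (λ _ → Carrier) _+_ 0# (Vec.zipWith _*_ cs bs)

  module WithEnum (elems : List Carrier) (q : ℕ) where

    InFq : Carrier → Set ℓ
    InFq x = pow x q ≈ x

    Fq : List Carrier
    Fq = filter (λ x → pow x q ≟ x) elems

    frob : ℕ → Carrier → Carrier
    frob i x = pow x (q ℕ.^ i)

    -- x and y represent the same projective point (x = c y, c in F_q^*)
    _∼_ : Carrier → Carrier → Set (c ⊔ ℓ)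
    x ∼ y = Any (λ a → (¬ (a ≈ 0#)) × (x ≈ a * y)) Fq

    _∼?_ : Decidable _∼_
    x ∼? y = any? (λ a → ¬? (a ≟ 0#) ×-dec (x ≟ (a * y))) Fq

    -- F_q-linear independence of k vectors: the generators of a
    -- (k-1)-dimensional projective subspace of PG(F_q^v)
    LinIndep : ∀ {k} → Vec Carrier k → Set (c ⊔ ℓ)
    LinIndep {k} bs = (cs : Vec Carrier k) → VecAll.All InFq cs →
                      lincomb cs bs ≈ 0# → VecAll.All (_≈ 0#) cs

    span : ∀ {k} → Vec Carrier k → List Carrier
    span {k} bs = map (λ cs → lincomb cs bs) (allTuples Fq k)

    SameSubspace : ∀ {k} → Vec Carrier k → Vec Carrier k → Set (c ⊔ ℓ)
    SameSubspace bs bs' = ∀ x → (Any (x ≈_) (span bs) → Any (x ≈_) (span bs'))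
                              × (Any (x ≈_) (span bs') → Any (x ≈_) (span bs))

    -- ordered pairs of representatives (x, y) of distinct points of the subspace
    PairOK : Carrier × Carrier → Set (c ⊔ ℓ)
    PairOK (x , y) = (¬ (x ≈ 0#)) × (¬ (y ≈ 0#)) × (¬ (x ∼ y))

    PairOK? : (p : Carrier × Carrier) → Dec (PairOK p)
    PairOK? (x , y) = ¬? (x ≟ 0#) ×-dec ¬? (y ≟ 0#) ×-dec ¬? (x ∼? y)

    -- (q-1)^2 times the multiplicity of the point [z] in ΔB
    -- (each pair of distinct points has (q-1)^2 pairs of representatives;
    --  x y^{-1} = [z] iff x ∼ z y)
    diffCount : ∀ {k} → Vec Carrier k → Carrier → ℕ
    diffCount bs z =
      length (filter (λ p → PairOK? p ×-dec (proj₁ p ∼? (z * proj₂ p)))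
                     (cartesianProduct (span bs) (span bs)))

    -- (q-1)^2 times the number of elements of ΔB (with multiplicity) lying in
    -- the Frob-orbit {[phi^i(z)] : 0 ≤ i < v} of [z]
    orbitCount : ∀ {k} → ℕ → Vec Carrier k → Carrier → ℕ
    orbitCount v bs z =
      length (filter (λ p → PairOK? p ×-dec
                        any? (λ i → proj₁ p ∼? (frob i z * proj₂ p)) (upTo v))
                     (cartesianProduct (span bs) (span bs)))

    -- [z] is a non-identity element of the Singer group
    NonIdentity : Carrier → Set ℓ
    NonIdentity z = (¬ (z ≈ 0#)) × (¬ InFq z)

    EvenlyDistributed : ∀ {k} → ℕ → List (Vec Carrier k) → Set (c ⊔ ℓ)
    EvenlyDistributed v I = ∀ z z' → NonIdentity z → NonIdentity z' →
      sum (map (λ B → orbitCount v B z) I) ≡ sum (map (λ B → orbitCount v B z') I)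

    -- (v,k,1)_q difference family: (k-1)-dim projective subspaces whose list
    -- of differences contains every element of [Z_v]_q^* exactly once
    DifferenceFamily : ∀ {k} → List (Vec Carrier k) → Set (c ⊔ ℓ)
    DifferenceFamily F = All LinIndep F ×
      (∀ z → NonIdentity z → sum (map (λ B → diffCount B z) F) ≡ (q ℕ.∸ 1) ℕ.* (q ℕ.∸ 1))

    frobFamily : ∀ {k} → ℕ → List (Vec Carrier k) → List (Vec Carrier k)
    frobFamily v I = concatMap (λ B → map (λ i → Vec.map (frob i) B) (upTo v)) I

module Submission where

-- The Frobenius map φ(x) = x^q transports differences: the differences of φⁱ B are the φⁱ-images of
-- those of B. Hence the family (φⁱ B), i < v, realises a point [z] as often as B realises points of the
-- Frobenius orbit of [z], and since v is prime with v ∤ q - 1 every non-identity orbit has exactly v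
-- points. Summing over all z, each block accounts for v (q - 1)(q^k - 1)(q^k - q) pairs of
-- representatives, while even distribution gives c ⋅ (q^v - q) for a common orbit count c. With
-- [v - 1]_q = u v [k]_q [k - 1]_q this forces c = (q - 1)², i.e. every point occurs exactly once.
-- (Differences are counted on representatives, each pair of points contributing (q - 1)² times.)

open import Defs
open import Algebra.Bundles using (CommutativeMonoid; CommutativeRing)
open import Relation.Binary using (Setoid; Decidable)
open import Data.Nat using (ℕ; suc)
import Data.Nat as ℕ
open import Data.Nat.Primality using (Prime)
open import Data.List using (List)
open import Relation.Binary.PropositionalEquality using (_≡_)

module Sums where

  open import Level using (Level)
  open import Data.Nat using (ℕ; zero; suc; _+_; _*_; _∸_; _≤_; _<_; z≤n; s≤s)
  open import Data.Nat.Properties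
  open import Data.Nat.ListAction using (sum)
  open import Data.Product using (_×_; _,_)
  open import Data.List using (List; []; _∷_; _++_; length; filter; map; concatMap; cartesianProduct; applyUpTo; upTo)
  open import Data.List.Relation.Unary.Any using (any?)
  open import Data.List.Relation.Unary.All using (All; []; _∷_)
  open import Data.List.Relation.Unary.AllPairs using (AllPairs; []; _∷_)
  import Relation.Unary as U
  open import Relation.Binary.PropositionalEquality using (_≡_; refl; cong; cong₂; sym; trans; module ≡-Reasoning)
  open import Relation.Nullary using (¬_; Dec; yes; no)
  open import Relation.Nullary.Decidable using (¬?; _×-dec_)
  open import Data.Empty using (⊥; ⊥-elim)
  open import Function using (_∘_)

  private variable
    a b p q : Level
    A : Set a
    B : Set b

  ∑ : List A → (A → ℕ) → ℕ
  ∑ xs f = sum (map f xs)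

  syntax ∑ xs (λ x → e) = ∑[ x ∈ xs ] e

  𝟙 : {P : Set p} → Dec P → ℕ
  𝟙 (yes _) = 1
  𝟙 (no _) = 0

  𝟙-yes : {P : Set p} (P? : Dec P) → P → 𝟙 P? ≡ 1
  𝟙-yes (yes _) _ = refl
  𝟙-yes (no ¬P) P = ⊥-elim (¬P P)

  𝟙-no : {P : Set p} (P? : Dec P) → ¬ P → 𝟙 P? ≡ 0
  𝟙-no (yes P) ¬P = ⊥-elim (¬P P)
  𝟙-no (no _) _ = refl

  𝟙-⇔ : {P Q : Set p} (P? : Dec P) (Q? : Dec Q) → (P → Q) → (Q → P) → 𝟙 P? ≡ 𝟙 Q?
  𝟙-⇔ (yes _) (yes _) _ _ = refl
  𝟙-⇔ (yes P) (no ¬Q) f _ = ⊥-elim (¬Q (f P))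
  𝟙-⇔ (no ¬P) (yes Q) _ g = ⊥-elim (¬P (g Q))
  𝟙-⇔ (no _) (no _) _ _ = refl

  𝟙-× : {P : Set p} {Q : Set q} (P? : Dec P) (Q? : Dec Q) → 𝟙 (P? ×-dec Q?) ≡ 𝟙 P? * 𝟙 Q?
  𝟙-× (yes _) (yes _) = refl
  𝟙-× (yes _) (no _) = refl
  𝟙-× (no _) (yes _) = refl
  𝟙-× (no _) (no _) = refl

  ∑-cong : ∀ xs {f g : A → ℕ} → (∀ x → f x ≡ g x) → ∑ xs f ≡ ∑ xs g
  ∑-cong [] _ = refl
  ∑-cong (x ∷ xs) f≗g = cong₂ _+_ (f≗g x) (∑-cong xs f≗g)

  ∑-cong-All : ∀ {xs} {f g : A → ℕ} → All (λ x → f x ≡ g x) xs → ∑ xs f ≡ ∑ xs g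
  ∑-cong-All [] = refl
  ∑-cong-All (fx≡gx ∷ f≗g) = cong₂ _+_ fx≡gx (∑-cong-All f≗g)

  ∑-+ : ∀ xs (f g : A → ℕ) → ∑[ x ∈ xs ] (f x + g x) ≡ ∑ xs f + ∑ xs g
  ∑-+ [] f g = refl
  ∑-+ (x ∷ xs) f g = begin
    f x + g x + ∑[ y ∈ xs ] (f y + g y) ≡⟨ cong (f x + g x +_) (∑-+ xs f g) ⟩
    f x + g x + (∑ xs f + ∑ xs g)       ≡⟨ +-assoc (f x) (g x) _ ⟩
    f x + (g x + (∑ xs f + ∑ xs g))     ≡⟨ cong (f x +_) (x+[y+z]≡y+[x+z] (g x) (∑ xs f) _) ⟩
    f x + (∑ xs f + (g x + ∑ xs g))     ≡⟨ +-assoc (f x) _ _ ⟨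
    f x + ∑ xs f + (g x + ∑ xs g)       ∎
    where
    open ≡-Reasoning
    x+[y+z]≡y+[x+z] : ∀ x y z → x + (y + z) ≡ y + (x + z)
    x+[y+z]≡y+[x+z] x y z = trans (sym (+-assoc x y z)) (trans (cong (_+ z) (+-comm x y)) (+-assoc y x z))

  ∑-const : ∀ (xs : List A) c → ∑[ _ ∈ xs ] c ≡ length xs * c
  ∑-const [] c = refl
  ∑-const (x ∷ xs) c = cong (c +_) (∑-const xs c)

  ∑-0 : ∀ (xs : List A) → ∑[ _ ∈ xs ] 0 ≡ 0
  ∑-0 xs = trans (∑-const xs 0) (*-zeroʳ (length xs))

  ∑-*ˡ : ∀ xs c (f : A → ℕ) → ∑[ x ∈ xs ] (c * f x) ≡ c * ∑ xs f
  ∑-*ˡ [] c f = sym (*-zeroʳ c)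
  ∑-*ˡ (x ∷ xs) c f = trans (cong (c * f x +_) (∑-*ˡ xs c f)) (sym (*-distribˡ-+ c (f x) (∑ xs f)))

  ∑-mono-≤ : ∀ xs {f g : A → ℕ} → (∀ x → f x ≤ g x) → ∑ xs f ≤ ∑ xs g
  ∑-mono-≤ [] _ = z≤n
  ∑-mono-≤ (x ∷ xs) f≤g = +-mono-≤ (f≤g x) (∑-mono-≤ xs f≤g)

  ∑-++ : ∀ xs ys (f : A → ℕ) → ∑ (xs ++ ys) f ≡ ∑ xs f + ∑ ys f
  ∑-++ [] ys f = refl
  ∑-++ (x ∷ xs) ys f = trans (cong (f x +_) (∑-++ xs ys f)) (sym (+-assoc (f x) _ _))

  ∑-map : ∀ (h : B → A) ys (f : A → ℕ) → ∑ (map h ys) f ≡ ∑ ys (f ∘ h)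
  ∑-map h [] f = refl
  ∑-map h (y ∷ ys) f = cong (f (h y) +_) (∑-map h ys f)

  ∑-comm : ∀ (xs : List A) (ys : List B) (F : A → B → ℕ) →
           ∑[ x ∈ xs ] ∑[ y ∈ ys ] F x y ≡ ∑[ y ∈ ys ] ∑[ x ∈ xs ] F x y
  ∑-comm [] ys F = sym (∑-0 ys)
  ∑-comm (x ∷ xs) ys F = trans (cong (∑ ys (F x) +_) (∑-comm xs ys F))
                               (sym (∑-+ ys (F x) (λ y → ∑[ x′ ∈ xs ] F x′ y)))

  ∑-cartesianProduct : ∀ (xs : List A) (ys : List B) (F : A × B → ℕ) →
                       ∑ (cartesianProduct xs ys) F ≡ ∑[ x ∈ xs ] ∑[ y ∈ ys ] F (x , y)
  ∑-cartesianProduct [] ys F = refl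
  ∑-cartesianProduct (x ∷ xs) ys F = trans (∑-++ (map (x ,_) ys) _ F)
    (cong₂ _+_ (∑-map (x ,_) ys F) (∑-cartesianProduct xs ys F))

  ∑-concatMap : ∀ (g : A → List B) (xs : List A) (F : B → ℕ) →
                ∑ (concatMap g xs) F ≡ ∑[ x ∈ xs ] ∑ (g x) F
  ∑-concatMap g [] F = refl
  ∑-concatMap g (x ∷ xs) F = trans (∑-++ (g x) (concatMap g xs) F) (cong (∑ (g x) F +_) (∑-concatMap g xs F))

  module _ {P : U.Pred A p} (P? : U.Decidable P) where

    length-filter≡∑𝟙 : ∀ xs → length (filter P? xs) ≡ ∑[ x ∈ xs ] 𝟙 (P? x)
    length-filter≡∑𝟙 [] = refl
    length-filter≡∑𝟙 (x ∷ xs) with P? x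
    ... | yes _ = cong suc (length-filter≡∑𝟙 xs)
    ... | no _ = length-filter≡∑𝟙 xs

    length-filter+length-filter¬ : ∀ xs → length (filter P? xs) + length (filter (¬? ∘ P?) xs) ≡ length xs
    length-filter+length-filter¬ [] = refl
    length-filter+length-filter¬ (x ∷ xs) with P? x
    ... | yes _ = cong suc (length-filter+length-filter¬ xs)
    ... | no _ = trans (+-suc _ _) (cong suc (length-filter+length-filter¬ xs))

    private
      ∑𝟙-excluded : ∀ {x} → P x → ∀ {ys} → All (λ y → P x → P y → ⊥) ys → ∑[ y ∈ ys ] 𝟙 (P? y) ≡ 0
      ∑𝟙-excluded Px [] = refl
      ∑𝟙-excluded Px {y ∷ ys} (excl ∷ excls) with P? y
      ... | yes Py = ⊥-elim (excl Px Py)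
      ... | no _ = ∑𝟙-excluded Px excls

    𝟙-any : ∀ {xs} → AllPairs (λ x y → P x → P y → ⊥) xs → 𝟙 (any? P? xs) ≡ ∑[ x ∈ xs ] 𝟙 (P? x)
    𝟙-any [] = refl
    𝟙-any {x ∷ xs} (excl ∷ excls) with P? x
    ... | yes Px = cong suc (sym (∑𝟙-excluded Px excl))
    ... | no _ with any? P? xs | 𝟙-any excls
    ...   | yes _ | eq = eq
    ...   | no _  | eq = eq

  ∑< : ℕ → (ℕ → ℕ) → ℕ
  ∑< zero f = 0
  ∑< (suc n) f = f 0 + ∑< n (λ i → f (suc i))

  syntax ∑< n (λ i → e) = ∑[ i < n ] e

  ∑-applyUpTo : ∀ (g : ℕ → A) (F : A → ℕ) n → ∑ (applyUpTo g n) F ≡ ∑[ i < n ] F (g i)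
  ∑-applyUpTo g F zero = refl
  ∑-applyUpTo g F (suc n) = cong (F (g 0) +_) (∑-applyUpTo (λ i → g (suc i)) F n)

  ∑-upTo : ∀ (f : ℕ → ℕ) n → ∑ (upTo n) f ≡ ∑[ i < n ] f i
  ∑-upTo f = ∑-applyUpTo (λ i → i) f

  ∑<-cong : ∀ n {f g : ℕ → ℕ} → (∀ i → i < n → f i ≡ g i) → ∑[ i < n ] f i ≡ ∑[ i < n ] g i
  ∑<-cong zero _ = refl
  ∑<-cong (suc n) f≗g = cong₂ _+_ (f≗g 0 (s≤s z≤n)) (∑<-cong n (λ i i<n → f≗g (suc i) (s≤s i<n)))

  ∑<-last : ∀ n (f : ℕ → ℕ) → ∑[ i < suc n ] f i ≡ ∑[ i < n ] f i + f n
  ∑<-last zero f = +-comm (f 0) 0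
  ∑<-last (suc n) f = trans (cong (f 0 +_) (∑<-last n (λ i → f (suc i)))) (sym (+-assoc (f 0) _ _))

  ∑<-reverse : ∀ n (f : ℕ → ℕ) → ∑[ i < n ] f (n ∸ suc i) ≡ ∑[ i < n ] f i
  ∑<-reverse zero f = refl
  ∑<-reverse (suc n) f = trans (cong (f n +_) (∑<-reverse n f)) (trans (+-comm (f n) _) (sym (∑<-last n f)))

  -- Summing f (n - i) for i < n visits n, n - 1, …, 1; this is a reindexing when f n = f 0.
  ∑<-reflect : ∀ n (f : ℕ → ℕ) → f n ≡ f 0 → ∑[ i < n ] f (n ∸ i) ≡ ∑[ i < n ] f i
  ∑<-reflect n f fn≡f0 = begin
    ∑[ i < n ] f (n ∸ i)             ≡⟨ ∑<-cong n (λ i i<n → cong f (+-∸-assoc 1 i<n)) ⟩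
    ∑[ i < n ] f (suc (n ∸ suc i))   ≡⟨ ∑<-reverse n (λ i → f (suc i)) ⟩
    ∑[ i < n ] f (suc i)             ≡⟨ +-cancelˡ-≡ (f 0) (∑[ i < n ] f (suc i)) (∑[ i < n ] f i) (trans (∑<-last n f) (trans (cong (∑[ i < n ] f i +_) fn≡f0) (+-comm _ (f 0)))) ⟩
    ∑[ i < n ] f i                   ∎
    where open ≡-Reasoning

module UniqueFold {a ℓ₁ b ℓ₂} (S : Setoid a ℓ₁) (M : CommutativeMonoid b ℓ₂) where

  open import Data.Product using (_×_; _,_; ∃)
  open import Data.List using (List; []; _∷_; _++_; map)
  open import Data.List.Relation.Unary.Any using (here; there)
  open import Data.List.Relation.Unary.All using (All; []; _∷_)
  open import Data.List.Relation.Unary.AllPairs using ([]; _∷_)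
  open import Data.List.Relation.Unary.Unique.Setoid S using (Unique)
  import Data.List.Relation.Unary.Unique.Setoid.Properties as Unique
  open import Data.List.Membership.Setoid S using (_∈_)
  open import Data.List.Membership.Setoid.Properties using (∈-resp-≈; ∈-map⁺; ∈-map⁻)
  open import Relation.Binary.PropositionalEquality as ≡ using (_≡_)
  open import Relation.Nullary using (¬_)
  open import Data.Empty using (⊥-elim)
  open import Function using (_∘_; case_of_)

  open Setoid S using (_≈_) renaming (Carrier to A; refl to ≈-refl; sym to ≈-sym; trans to ≈-trans)
  open CommutativeMonoid M renaming (Carrier to C; _≈_ to _≋_)
  open import Relation.Binary.Reasoning.Setoid setoid

  fold : (A → C) → List A → C
  fold f [] = ε
  fold f (x ∷ xs) = f x ∙ fold f xs

  fold-map : ∀ (f : A → C) h xs → fold f (map h xs) ≡ fold (f ∘ h) xs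
  fold-map f h [] = ≡.refl
  fold-map f h (x ∷ xs) = ≡.cong (f (h x) ∙_) (fold-map f h xs)

  private
    split : ∀ {x xs} → x ∈ xs → ∃ λ ((l , y , r) : List A × A × List A) → (xs ≡ l ++ y ∷ r) × (x ≈ y)
    split {xs = x ∷ xs} (here x≈y) = ([] , x , xs) , ≡.refl , x≈y
    split {xs = x ∷ xs} (there x∈xs) with split x∈xs
    ... | (l , y , r) , ≡.refl , x≈y = (x ∷ l , y , r) , ≡.refl , x≈y

    ∉-All≉ : ∀ {x y ys} → All (λ w → ¬ (y ≈ w)) ys → x ∈ ys → ¬ (x ≈ y)
    ∉-All≉ (y≉w ∷ _) (here x≈w) x≈y = y≉w (≈-trans (≈-sym x≈y) x≈w)
    ∉-All≉ (_ ∷ y≉ws) (there x∈ys) x≈y = ∉-All≉ y≉ws x∈ys x≈y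

    ∈-remove : ∀ {x} l r {y} → x ∈ (l ++ y ∷ r) → ¬ (x ≈ y) → x ∈ (l ++ r)
    ∈-remove [] r (here x≈y) x≉y = ⊥-elim (x≉y x≈y)
    ∈-remove [] r (there x∈r) _ = x∈r
    ∈-remove (w ∷ l) r (here x≈w) _ = here x≈w
    ∈-remove (w ∷ l) r (there x∈) x≉y = there (∈-remove l r x∈ x≉y)

    ∈-insert : ∀ {x} l r {y} → x ∈ (l ++ r) → x ∈ (l ++ y ∷ r)
    ∈-insert [] r x∈ = there x∈
    ∈-insert (w ∷ l) r (here x≈w) = here x≈w
    ∈-insert (w ∷ l) r (there x∈) = there (∈-insert l r x∈)

    ∈-middle : ∀ l {y r} → y ∈ (l ++ y ∷ r)
    ∈-middle [] = here ≈-refl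
    ∈-middle (_ ∷ l) = there (∈-middle l)

    unique-remove : ∀ l y r → Unique (l ++ y ∷ r) → Unique (l ++ r)
    unique-remove [] y r (_ ∷ u) = u
    unique-remove (x ∷ l) y r (x≉ ∷ u) = all-remove l x≉ ∷ unique-remove l y r u
      where
      all-remove : ∀ l′ {r′} → All (λ w → ¬ (x ≈ w)) (l′ ++ y ∷ r′) → All (λ w → ¬ (x ≈ w)) (l′ ++ r′)
      all-remove [] (_ ∷ x≉r) = x≉r
      all-remove (w ∷ l′) (x≉w ∷ x≉) = x≉w ∷ all-remove l′ x≉

    unique-removed : ∀ l y r {x} → Unique (l ++ y ∷ r) → x ∈ (l ++ r) → ¬ (x ≈ y)
    unique-removed [] y r (y≉ ∷ _) x∈r = ∉-All≉ y≉ x∈r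
    unique-removed (w ∷ l) y r (w≉ ∷ _) (here x≈w) x≈y = ∉-All≉ w≉ (∈-middle l) (≈-trans (≈-sym x≈y) x≈w)
    unique-removed (w ∷ l) y r (_ ∷ u) (there x∈) = unique-removed l y r u x∈

  module _ (f : A → C) (f-cong : ∀ {x y} → x ≈ y → f x ≋ f y) where

    private
      fold-extract : ∀ l y r → fold f (l ++ y ∷ r) ≋ f y ∙ fold f (l ++ r)
      fold-extract [] y r = refl
      fold-extract (x ∷ l) y r = begin
        f x ∙ fold f (l ++ y ∷ r)     ≈⟨ ∙-congˡ (fold-extract l y r) ⟩
        f x ∙ (f y ∙ fold f (l ++ r)) ≈⟨ assoc _ _ _ ⟨
        (f x ∙ f y) ∙ fold f (l ++ r) ≈⟨ ∙-congʳ (comm _ _) ⟩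
        (f y ∙ f x) ∙ fold f (l ++ r) ≈⟨ assoc _ _ _ ⟩
        f y ∙ (f x ∙ fold f (l ++ r)) ∎

    fold-sameElements : ∀ xs ys → Unique xs → Unique ys →
                        (∀ {z} → z ∈ xs → z ∈ ys) → (∀ {z} → z ∈ ys → z ∈ xs) →
                        fold f xs ≋ fold f ys
    fold-sameElements [] [] _ _ _ _ = refl
    fold-sameElements [] (y ∷ ys) _ _ _ ys⊆xs with ys⊆xs (here ≈-refl)
    ... | ()
    fold-sameElements (x ∷ xs) ys (x≉ ∷ u) uys xs⊆ys ys⊆xs with split (xs⊆ys (here ≈-refl))
    ... | (l , y , r) , ≡.refl , x≈y = sym (begin
      fold f (l ++ y ∷ r)   ≈⟨ fold-extract l y r ⟩
      f y ∙ fold f (l ++ r) ≈⟨ ∙-cong (f-cong (≈-sym x≈y)) (sym rest) ⟩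
      f x ∙ fold f xs       ∎)
      where
      rest : fold f xs ≋ fold f (l ++ r)
      rest = fold-sameElements xs (l ++ r) u (unique-remove l y r uys)
        (λ z∈xs → ∈-remove l r (xs⊆ys (there z∈xs)) (λ z≈y → ∉-All≉ x≉ z∈xs (≈-trans z≈y (≈-sym x≈y))))
        (λ z∈lr → case ys⊆xs (∈-insert l r z∈lr) of λ where
          (here z≈x) → ⊥-elim (unique-removed l y r uys z∈lr (≈-trans z≈x x≈y))
          (there z∈xs) → z∈xs)

    fold-∘-bijection : ∀ (h : A → A) → (∀ {x y} → x ≈ y → h x ≈ h y) → (∀ {x y} → h x ≈ h y → x ≈ y) →
                       ∀ {xs} → Unique xs → (∀ {x} → x ∈ xs → h x ∈ xs) →
                       (∀ {y} → y ∈ xs → ∃ λ x → x ∈ xs × y ≈ h x) →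
                       fold (f ∘ h) xs ≋ fold f xs
    fold-∘-bijection h h-cong h-inj {xs} u maps-into onto = begin
      fold (f ∘ h) xs   ≡⟨ fold-map f h xs ⟨
      fold f (map h xs) ≈⟨ fold-sameElements (map h xs) xs (Unique.map⁺ S S h-inj u) u image⊆ ⊆image ⟩
      fold f xs         ∎
      where
      image⊆ : ∀ {y} → y ∈ map h xs → y ∈ xs
      image⊆ y∈ = let (x , x∈ , y≈hx) = ∈-map⁻ S S y∈ in ∈-resp-≈ S (≈-sym y≈hx) (maps-into x∈)
      ⊆image : ∀ {y} → y ∈ xs → y ∈ map h xs
      ⊆image y∈ = let (x , x∈ , y≈hx) = onto y∈ in ∈-resp-≈ S (≈-sym y≈hx) (∈-map⁺ S S h-cong x∈)

module BinomialCoefficients where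

  open import Data.Nat using (ℕ; zero; suc; _+_; _*_; _<_; nonTrivial⇒n>1)
  open import Data.Nat.Properties using (*-zeroʳ; *-identityˡ; *-identityʳ; *-comm; <⇒≱)
  open import Data.Nat.Combinatorics using (_C_; nCk+nC[k+1]≡[n+1]C[k+1])
  open import Data.Nat.Divisibility using (_∣_; divides; ∣⇒≤)
  open import Data.Nat.Primality using (Prime; euclidsLemma; prime⇒nonTrivial)
  open import Data.Sum using (inj₁; inj₂)
  open import Relation.Binary.PropositionalEquality using (_≡_; refl; cong; cong₂; sym; trans; subst; module ≡-Reasoning)
  open import Data.Nat.Solver using (module +-*-Solver)
  open +-*-Solver using (solve; _:+_; _:*_; _:=_; con)
  open import Data.Empty using (⊥-elim)

  -- Pascal's recursion as a definition; the library's _C_ is defined by division.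
  pascal : ℕ → ℕ → ℕ
  pascal n zero = 1
  pascal zero (suc k) = 0
  pascal (suc n) (suc k) = pascal n k + pascal n (suc k)

  C≡pascal : ∀ n k → n C k ≡ pascal n k
  C≡pascal n zero = refl
  C≡pascal zero (suc k) = refl
  C≡pascal (suc n) (suc k) =
    trans (sym (nCk+nC[k+1]≡[n+1]C[k+1] n k)) (cong₂ _+_ (C≡pascal n k) (C≡pascal n (suc k)))

  pascal-absorption : ∀ n k → suc k * pascal (suc n) (suc k) ≡ suc n * pascal n k
  pascal-absorption zero zero = refl
  pascal-absorption zero (suc k) = *-zeroʳ (suc (suc k))
  pascal-absorption (suc n) zero = begin
    1 * suc (pascal (suc n) 1) ≡⟨ *-identityˡ _ ⟩
    suc (pascal (suc n) 1)     ≡⟨ cong suc (trans (sym (*-identityˡ _)) (trans (pascal-absorption n zero) (*-identityʳ _))) ⟩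
    suc (suc n)                ≡⟨ *-identityʳ _ ⟨
    suc (suc n) * 1            ∎
    where open ≡-Reasoning
  pascal-absorption (suc n) (suc k) = begin
    suc (suc k) * (A + B)                       ≡⟨ solve 3 (λ k A B → (con 2 :+ k) :* (A :+ B) := A :+ (con 1 :+ k) :* A :+ (con 2 :+ k) :* B) refl k A B ⟩
    A + suc k * A + suc (suc k) * B             ≡⟨ cong₂ (λ s t → A + s + t) (pascal-absorption n k) (pascal-absorption n (suc k)) ⟩
    A + suc n * pascal n k + suc n * pascal n (suc k) ≡⟨ solve 4 (λ n A a b → A :+ (con 1 :+ n) :* a :+ (con 1 :+ n) :* b := A :+ (con 1 :+ n) :* (a :+ b)) refl n A (pascal n k) (pascal n (suc k)) ⟩
    A + suc n * A                               ≡⟨ solve 2 (λ n A → A :+ (con 1 :+ n) :* A := (con 2 :+ n) :* A) refl n A ⟩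
    suc (suc n) * A                             ∎
    where
    open ≡-Reasoning
    A = pascal (suc n) (suc k)
    B = pascal (suc n) (suc (suc k))

  prime∣pCk : ∀ {p k} → Prime p → 0 < k → k < p → p ∣ p C k
  prime∣pCk {zero} p-prime _ _ with () ← nonTrivial⇒n>1 0 {{prime⇒nonTrivial p-prime}}
  prime∣pCk {suc n} {suc k} p-prime _ k<p
    with euclidsLemma (suc k) (pascal (suc n) (suc k)) p-prime
           (divides (pascal n k) (trans (pascal-absorption n k) (*-comm (suc n) (pascal n k))))
  ... | inj₁ p∣k+1 = ⊥-elim (<⇒≱ k<p (∣⇒≤ p∣k+1))
  ... | inj₂ p∣pCk = subst (suc n ∣_) (sym (C≡pascal (suc n) (suc k))) p∣pCk

module Field {c ℓ} (R : CommutativeRing c ℓ) (_≟_ : Decidable (CommutativeRing._≈_ R))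
             (isField : FF.IsField R _≟_) where

  open import Level using (Lift; lift; _⊔_)
  open import Data.Nat as ℕ using (ℕ; zero; suc; _≤_; _<_; z≤n; s≤s)
  import Data.Nat.Properties as ℕ
  open import Data.Product using (_×_; _,_; ∃; ∃₂; proj₁; proj₂)
  open import Data.List using (List; []; _∷_; length)
  open import Data.List.Relation.Unary.All using (All; []; _∷_)
  open import Data.List.Relation.Unary.AllPairs using (AllPairs; []; _∷_)
  open import Relation.Binary.PropositionalEquality as ≡ using (_≡_)
  open import Relation.Nullary using (¬_; yes; no)
  open import Data.Empty using (⊥-elim)
  import Algebra.Solver.Ring.NaturalCoefficients.Default as Solver
  import Algebra.Properties.Ring as RingProperties

  open CommutativeRing R public
  open FF R _≟_ public
  open Solver commutativeSemiring public using (solve; _:+_; _:*_; _:=_)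
  open RingProperties ring public
    using (-‿distribˡ-*; x[y-z]≈xy-xz; +-cancelˡ; +-cancelʳ; +-identityˡ-unique; -‿+-comm)
    renaming (x∙y⁻¹≈ε⇒x≈y to x-y≈0⇒x≈y; x≈y⇒x∙y⁻¹≈ε to x≈y⇒x-y≈0)
  open import Relation.Binary.Reasoning.Setoid setoid

  1≉0 : ¬ (1# ≈ 0#)
  1≉0 1≈0 = proj₁ isField (sym 1≈0)

  inverse : ∀ x → ¬ (x ≈ 0#) → ∃ λ y → x * y ≈ 1#
  inverse = proj₂ isField

  no-zero-divisors : ∀ {x y} → x * y ≈ 0# → ¬ (x ≈ 0#) → y ≈ 0#
  no-zero-divisors {x} {y} xy≈0 x≉0 with inverse x x≉0
  ... | x⁻¹ , xx⁻¹≈1 = begin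
    y              ≈⟨ *-identityˡ y ⟨
    1# * y         ≈⟨ *-congʳ (trans (sym xx⁻¹≈1) (*-comm x x⁻¹)) ⟩
    (x⁻¹ * x) * y  ≈⟨ *-assoc x⁻¹ x y ⟩
    x⁻¹ * (x * y)  ≈⟨ *-congˡ xy≈0 ⟩
    x⁻¹ * 0#       ≈⟨ zeroʳ x⁻¹ ⟩
    0#             ∎

  *-nonzero : ∀ {x y} → ¬ (x ≈ 0#) → ¬ (y ≈ 0#) → ¬ (x * y ≈ 0#)
  *-nonzero x≉0 y≉0 xy≈0 = y≉0 (no-zero-divisors xy≈0 x≉0)

  *-cancelˡ : ∀ {a x y} → ¬ (a ≈ 0#) → a * x ≈ a * y → x ≈ y
  *-cancelˡ {a} {x} {y} a≉0 ax≈ay =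
    x-y≈0⇒x≈y x y (no-zero-divisors (trans (x[y-z]≈xy-xz a x y) (x≈y⇒x-y≈0 ax≈ay)) a≉0)

  pow-cong : ∀ {x y} n → x ≈ y → pow x n ≈ pow y n
  pow-cong zero _ = refl
  pow-cong (suc n) x≈y = *-cong x≈y (pow-cong n x≈y)

  pow-distribˡ-+-* : ∀ x m n → pow x (m ℕ.+ n) ≈ pow x m * pow x n
  pow-distribˡ-+-* x zero n = sym (*-identityˡ _)
  pow-distribˡ-+-* x (suc m) n = trans (*-congˡ (pow-distribˡ-+-* x m n)) (sym (*-assoc x _ _))

  pow-*-assoc : ∀ x m n → pow x (m ℕ.* n) ≈ pow (pow x m) n
  pow-*-assoc x m zero = reflexive (≡.cong (pow x) (ℕ.*-zeroʳ m))
  pow-*-assoc x m (suc n) = begin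
    pow x (m ℕ.* suc n)       ≡⟨ ≡.cong (pow x) (ℕ.*-suc m n) ⟩
    pow x (m ℕ.+ m ℕ.* n)     ≈⟨ pow-distribˡ-+-* x m (m ℕ.* n) ⟩
    pow x m * pow x (m ℕ.* n) ≈⟨ *-congˡ (pow-*-assoc x m n) ⟩
    pow x m * pow (pow x m) n ∎

  pow-distribʳ-* : ∀ x y n → pow (x * y) n ≈ pow x n * pow y n
  pow-distribʳ-* x y zero = sym (*-identityˡ 1#)
  pow-distribʳ-* x y (suc n) = trans (*-congˡ (pow-distribʳ-* x y n)) (solve 4 (λ a b c d → (a :* b) :* (c :* d) := (a :* c) :* (b :* d)) refl x y (pow x n) (pow y n))

  pow-comm : ∀ x m n → pow (pow x m) n ≈ pow (pow x n) m
  pow-comm x m n = trans (sym (pow-*-assoc x m n)) (trans (reflexive (≡.cong (pow x) (ℕ.*-comm m n))) (pow-*-assoc x n m))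

  pow-1# : ∀ n → pow 1# n ≈ 1#
  pow-1# zero = refl
  pow-1# (suc n) = trans (*-identityˡ _) (pow-1# n)

  pow-nonzero : ∀ {x} n → ¬ (x ≈ 0#) → ¬ (pow x n ≈ 0#)
  pow-nonzero zero _ = 1≉0
  pow-nonzero (suc n) x≉0 = *-nonzero x≉0 (pow-nonzero n x≉0)

  pow≈0⇒x≈0 : ∀ {x} n → pow x n ≈ 0# → x ≈ 0#
  pow≈0⇒x≈0 {x} n xⁿ≈0 with x ≟ 0#
  ... | yes x≈0 = x≈0
  ... | no x≉0 = ⊥-elim (pow-nonzero n x≉0 xⁿ≈0)

  -- Monic d f: f is the evaluation map of a monic polynomial of degree d, in Horner form.
  Monic : ℕ → (Carrier → Carrier) → Set (c ⊔ ℓ)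
  Monic zero f = Lift c (∀ x → f x ≈ 1#)
  Monic (suc d) f = ∃₂ λ (g : Carrier → Carrier) (k : Carrier) → Monic d g × (∀ x → f x ≈ x * g x + k)

  Monic-cong : ∀ d {f g} → Monic d g → (∀ x → f x ≈ g x) → Monic d f
  Monic-cong zero (lift g≈1) f≈g = lift (λ x → trans (f≈g x) (g≈1 x))
  Monic-cong (suc d) (h , k , h-monic , g≈) f≈g = h , k , h-monic , (λ x → trans (f≈g x) (g≈ x))

  pow-monic : ∀ n → Monic n (λ x → pow x n)
  pow-monic zero = lift (λ _ → refl)
  pow-monic (suc n) = (λ x → pow x n) , 0# , pow-monic n , (λ _ → sym (+-identityʳ _))

  Monic-subtract : ∀ d {f} → Monic (suc d) f → ∀ t → Monic (suc d) (λ x → f x - t)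
  Monic-subtract d (g , k , g-monic , f≈) t = g , (k - t) , g-monic , (λ x → trans (+-congʳ (f≈ x)) (+-assoc _ _ _))

  Monic-+-lower : ∀ d e {f g} → Monic d f → Monic e g → e < d → Monic d (λ x → f x + g x)
  Monic-+-lower (suc d) zero (F , k , F-monic , f≈) (lift g≈1) _ =
    F , (k + 1#) , F-monic , (λ x → trans (+-cong (f≈ x) (g≈1 x)) (+-assoc _ _ _))
  Monic-+-lower (suc d) (suc e) (F , k , F-monic , f≈) (G , k′ , G-monic , g≈) (s≤s e<d) =
    (λ x → F x + G x) , (k + k′) , Monic-+-lower d e F-monic G-monic e<d ,
    (λ x → trans (+-cong (f≈ x) (g≈ x))
                 (solve 5 (λ x a b u w → (x :* a :+ u) :+ (x :* b :+ w) := x :* (a :+ b) :+ (u :+ w)) refl x (F x) (G x) k k′))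

  Monic-divide : ∀ d {f} → Monic (suc d) f → ∀ a →
                 ∃ λ (h : Carrier → Carrier) → Monic d h × (∀ x → f x ≈ (x - a) * h x + f a)
  Monic-divide d {f} (g , u , g-monic , f≈) a with divide-step d g-monic
    where
    divide-step : ∀ d {g} → Monic d g →
                  ∃ λ (k : Carrier → Carrier) → (∀ x → g x ≈ (x - a) * k x + g a) × Monic d (λ x → x * k x + g a)
    divide-step zero {g} (lift g≈1) =
      (λ _ → 0#) , (λ x → trans (g≈1 x) (sym (trans (+-congʳ (zeroʳ _)) (trans (+-identityˡ _) (g≈1 a))))) ,
      lift (λ x → trans (+-congʳ (zeroʳ x)) (trans (+-identityˡ _) (g≈1 a)))
    divide-step (suc d) g-monic with Monic-divide d g-monic a
    ... | h , h-monic , g≈ = h , g≈ , (h , _ , h-monic , (λ _ → refl))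
  ... | k , g≈ , monic = (λ x → x * k x + g a) , monic , (λ x → begin
      f x                                     ≈⟨ f≈ x ⟩
      x * g x + u                             ≈⟨ +-congʳ (*-congˡ (g≈ x)) ⟩
      x * ((x - a) * k x + g a) + u           ≈⟨ horner x (k x) (g a) ⟩
      (x - a) * (x * k x + g a) + (a * g a + u) ≈⟨ +-congˡ (sym (f≈ a)) ⟩
      (x - a) * (x * k x + g a) + f a         ∎)
    where
    horner : ∀ x k G → x * ((x - a) * k + G) + u ≈ (x - a) * (x * k + G) + (a * G + u)
    horner x k G = begin
      x * ((x - a) * k + G) + u                       ≈⟨ +-identityʳ _ ⟨
      x * ((x - a) * k + G) + u + 0#                  ≈⟨ +-congˡ (trans (sym (zeroˡ G)) (*-congʳ (sym (-‿inverseˡ a)))) ⟩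
      x * ((x - a) * k + G) + u + (- a + a) * G       ≈⟨ solve 6 (λ x w a k G u → x :* ((x :+ w) :* k :+ G) :+ u :+ (w :+ a) :* G := (x :+ w) :* (x :* k :+ G) :+ (a :* G :+ u)) refl x (- a) a k G u ⟩
      (x - a) * (x * k + G) + (a * G + u)             ∎

  Monic-roots≤degree : ∀ d {f} → Monic d f → ∀ rs → AllPairs (λ x y → ¬ (x ≈ y)) rs → All (λ r → f r ≈ 0#) rs →
                       length rs ≤ d
  Monic-roots≤degree d _ [] _ _ = z≤n
  Monic-roots≤degree zero (lift f≈1) (r ∷ _) _ (fr≈0 ∷ _) = ⊥-elim (1≉0 (trans (sym (f≈1 r)) fr≈0))
  Monic-roots≤degree (suc d) {f} f-monic (r ∷ rs) (r≉ ∷ distinct) (fr≈0 ∷ roots) with Monic-divide d f-monic r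
  ... | h , h-monic , f≈ = s≤s (Monic-roots≤degree d h-monic rs distinct (roots-of-quotient r≉ roots))
    where
    roots-of-quotient : ∀ {ss} → All (λ s → ¬ (r ≈ s)) ss → All (λ s → f s ≈ 0#) ss → All (λ s → h s ≈ 0#) ss
    roots-of-quotient [] [] = []
    roots-of-quotient {s ∷ _} (r≉s ∷ r≉) (fs≈0 ∷ fss≈0) =
      no-zero-divisors s-r*hs≈0 (λ s-r≈0 → r≉s (sym (x-y≈0⇒x≈y s r s-r≈0))) ∷ roots-of-quotient r≉ fss≈0
      where
      s-r*hs≈0 : (s - r) * h s ≈ 0#
      s-r*hs≈0 = begin
        (s - r) * h s        ≈⟨ +-identityʳ _ ⟨
        (s - r) * h s + 0#   ≈⟨ +-congˡ (sym fr≈0) ⟩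
        (s - r) * h s + f r  ≈⟨ f≈ s ⟨
        f s                  ≈⟨ fs≈0 ⟩
        0#                   ∎

module FiniteField {c ℓ} (R : CommutativeRing c ℓ) (_≟_ : Decidable (CommutativeRing._≈_ R))
                   (isField : FF.IsField R _≟_)
                   (elems : List (CommutativeRing.Carrier R)) (n : ℕ)
                   (enumeration : FF.FiniteEnumeration R _≟_ elems n) where

  open import Data.Nat as ℕ using (zero; suc; _<_; s≤s; z≤n)
  import Data.Nat.Properties as ℕ
  open import Data.Nat.Combinatorics using (_C_; nCn≡1)
  open import Data.Nat.Divisibility using (divides)
  open import Data.Nat.Primality using (Prime; prime⇒nonTrivial)
  open import Data.Fin as Fin using (Fin; toℕ; inject₁; fromℕ)
  import Data.Fin.Properties as Fin
  open import Data.Product using (_×_; _,_; ∃; proj₁; proj₂)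
  open import Data.List using ([]; _∷_; length; filter)
  open import Data.List.Relation.Unary.Any using (here; there)
  open import Data.List.Relation.Unary.All using (All; []; _∷_)
  import Data.List.Relation.Unary.All.Properties as All
  open import Data.List.Relation.Unary.AllPairs using ([]; _∷_)
  open import Relation.Binary.PropositionalEquality as ≡ using (_≡_)
  open import Relation.Nullary using (¬_; Dec; yes; no)
  open import Relation.Nullary.Decidable using (¬?)
  open import Data.Empty using (⊥-elim)
  open import Function using (_∘_; id)
  import Algebra.Properties.CommutativeSemiring.Binomial as BinomialTheorem
  import Algebra.Properties.Semiring.Exp as Exp
  import Algebra.Properties.Semiring.Mult as Mult
  import Algebra.Properties.Monoid.Sum as MonoidSum
  open BinomialCoefficients using (prime∣pCk)
  open Sums using (length-filter+length-filter¬)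

  open Field R _≟_ isField public
  open import Data.List.Membership.Setoid setoid public using (_∈_)
  open import Data.List.Relation.Unary.Unique.Setoid setoid public using (Unique)
  open import Data.List.Membership.Setoid.Properties public using (∈-resp-≈; ∈-filter⁺; ∈-filter⁻)
  import Data.List.Relation.Unary.Unique.Setoid.Properties as Unique
  open Mult semiring renaming (_×_ to _·_) using (×1-homo-*; ×-assocˡ; ×-congʳ; ×-assoc-*)
  open import Relation.Binary.Reasoning.Setoid setoid

  ∈-elems : ∀ x → x ∈ elems
  ∈-elems = proj₁ enumeration

  elems-unique : Unique elems
  elems-unique = proj₁ (proj₂ enumeration)

  length-elems : length elems ≡ n
  length-elems = proj₂ (proj₂ enumeration)

  nonzero? : (x : Carrier) → Dec (¬ (x ≈ 0#))
  nonzero? = ¬? ∘ (_≟ 0#)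

  length-filter-≈ : ∀ t {xs} → Unique xs → t ∈ xs → length (filter (_≟ t) xs) ≡ 1
  length-filter-≈ t {x ∷ xs} (x≉ ∷ u) t∈ with x ≟ t | t∈
  ... | yes x≈t | _ = ≡.cong suc (none x≉)
    where
    none : ∀ {ys} → All (λ y → ¬ (x ≈ y)) ys → length (filter (_≟ t) ys) ≡ 0
    none [] = ≡.refl
    none {y ∷ _} (x≉y ∷ x≉) with y ≟ t
    ... | yes y≈t = ⊥-elim (x≉y (trans x≈t (sym y≈t)))
    ... | no _ = none x≉
  ... | no x≉t | here t≈x = ⊥-elim (x≉t (sym t≈x))
  ... | no _ | there t∈xs = length-filter-≈ t u t∈xs

  length-filter-≉ : ∀ t {xs} → Unique xs → t ∈ xs → suc (length (filter (¬? ∘ (_≟ t)) xs)) ≡ length xs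
  length-filter-≉ t {xs} u t∈ = ≡.trans (≡.cong (ℕ._+ length (filter (¬? ∘ (_≟ t)) xs)) (≡.sym (length-filter-≈ t u t∈)))
                                        (length-filter+length-filter¬ (_≟ t) xs)

  -- Translation by x permutes the field, so the sum of all elements is unchanged.
  n·x≈0 : ∀ x → n · x ≈ 0#
  n·x≈0 x = ≡.subst (λ m → m · x ≈ 0#) length-elems
              (+-identityˡ-unique _ (Σ id elems) (trans (sym (Σ-translate elems)) translation-invariant))
    where
    open UniqueFold setoid +-commutativeMonoid renaming (fold to Σ)
    Σ-translate : ∀ xs → Σ (x +_) xs ≈ length xs · x + Σ id xs
    Σ-translate [] = sym (+-identityˡ 0#)
    Σ-translate (w ∷ xs) = trans (+-congˡ (Σ-translate xs))
      (solve 4 (λ x w a b → (x :+ w) :+ (a :+ b) := (x :+ a) :+ (w :+ b)) refl x w _ _)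
    translation-invariant : Σ (x +_) elems ≈ Σ id elems
    translation-invariant = fold-∘-bijection id (λ e → e) (x +_) +-congˡ (+-cancelˡ x _ _) elems-unique
      (λ _ → ∈-elems _)
      (λ {y} _ → (- x + y) , ∈-elems _ , sym (trans (sym (+-assoc x (- x) y)) (trans (+-congʳ (-‿inverseʳ x)) (+-identityˡ y))))

  -- Multiplication by x ≠ 0 permutes the nonzero elements, so their product is unchanged.
  pow-n : ∀ x → pow x n ≈ x
  pow-n x = ≡.subst (λ m → pow x m ≈ x) (≡.trans (length-filter-≉ 0# elems-unique (∈-elems 0#)) length-elems)
                    (by-cases (x ≟ 0#))
    where
    open UniqueFold setoid *-commutativeMonoid renaming (fold to Π)
    nonzeros = filter nonzero? elems
    ≉0-resp : ∀ {a b} → a ≈ b → ¬ (a ≈ 0#) → ¬ (b ≈ 0#)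
    ≉0-resp a≈b a≉0 b≈0 = a≉0 (trans a≈b b≈0)
    Π-scale : ∀ xs → Π (x *_) xs ≈ pow x (length xs) * Π id xs
    Π-scale [] = sym (*-identityˡ 1#)
    Π-scale (w ∷ xs) = trans (*-congˡ (Π-scale xs))
      (solve 4 (λ x w a b → (x :* w) :* (a :* b) := (x :* a) :* (w :* b)) refl x w _ _)
    Π-nonzero : ∀ {xs} → All (λ w → ¬ (w ≈ 0#)) xs → ¬ (Π id xs ≈ 0#)
    Π-nonzero [] = 1≉0
    Π-nonzero (w≉0 ∷ ws≉0) = *-nonzero w≉0 (Π-nonzero ws≉0)
    pow-#nonzeros : ¬ (x ≈ 0#) → pow x (length nonzeros) ≈ 1#
    pow-#nonzeros x≉0 with inverse x x≉0
    ... | x⁻¹ , xx⁻¹≈1 = *-cancelˡ (Π-nonzero (All.all-filter nonzero? elems)) (begin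
      Π id nonzeros * pow x (length nonzeros) ≈⟨ *-comm _ _ ⟩
      pow x (length nonzeros) * Π id nonzeros ≈⟨ Π-scale nonzeros ⟨
      Π (x *_) nonzeros                       ≈⟨ fold-∘-bijection id (λ e → e) (x *_) *-congˡ (*-cancelˡ x≉0)
                                                    (Unique.filter⁺ setoid nonzero? elems-unique) scale-into scale-onto ⟩
      Π id nonzeros                           ≈⟨ *-identityʳ _ ⟨
      Π id nonzeros * 1#                      ∎)
      where
      nonzero⁺ : ∀ {y} → ¬ (y ≈ 0#) → y ∈ nonzeros
      nonzero⁺ y≉0 = ∈-filter⁺ setoid nonzero? ≉0-resp (∈-elems _) y≉0
      nonzero⁻ : ∀ {y} → y ∈ nonzeros → ¬ (y ≈ 0#)
      nonzero⁻ y∈ = proj₂ (∈-filter⁻ setoid nonzero? ≉0-resp {xs = elems} y∈)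
      scale-into : ∀ {y} → y ∈ nonzeros → x * y ∈ nonzeros
      scale-into y∈ = nonzero⁺ (*-nonzero x≉0 (nonzero⁻ y∈))
      x⁻¹≉0 : ¬ (x⁻¹ ≈ 0#)
      x⁻¹≉0 x⁻¹≈0 = 1≉0 (trans (sym xx⁻¹≈1) (trans (*-congˡ x⁻¹≈0) (zeroʳ x)))
      scale-onto : ∀ {y} → y ∈ nonzeros → ∃ λ w → w ∈ nonzeros × y ≈ x * w
      scale-onto {y} y∈ = x⁻¹ * y , nonzero⁺ (*-nonzero x⁻¹≉0 (nonzero⁻ y∈)) ,
        sym (trans (sym (*-assoc x x⁻¹ y)) (trans (*-congʳ xx⁻¹≈1) (*-identityˡ y)))
    by-cases : Dec (x ≈ 0#) → pow x (suc (length nonzeros)) ≈ x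
    by-cases (yes x≈0) = trans (*-congʳ x≈0) (trans (zeroˡ _) (sym x≈0))
    by-cases (no x≉0) = trans (*-congˡ (pow-#nonzeros x≉0)) (*-identityʳ x)

  open Exp semiring using (_^_)
  open BinomialTheorem commutativeSemiring using (theorem; binomialTerm)
  open MonoidSum +-monoid using (sum; sum-init-last)

  private
    m·0≈0 : ∀ m → m · 0# ≈ 0#
    m·0≈0 zero = refl
    m·0≈0 (suc m) = trans (+-identityˡ _) (m·0≈0 m)

    pow≈^ : ∀ x m → pow x m ≈ x ^ m
    pow≈^ x zero = refl
    pow≈^ x (suc m) = *-congˡ (pow≈^ x m)

    sum-zero : ∀ {m} (t : Fin m → Carrier) → (∀ i → t i ≈ 0#) → sum t ≈ 0#
    sum-zero {zero} t _ = refl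
    sum-zero {suc m} t t≈0 = trans (+-cong (t≈0 Fin.zero) (sum-zero (t ∘ Fin.suc) (t≈0 ∘ Fin.suc))) (+-identityˡ 0#)

  -- In the binomial expansion of (x + y)^p only the two outer terms survive, since p ∣ p C j for 0 < j < p.
  freshman's-dream : ∀ {q} → Prime q → (∀ x → q · x ≈ 0#) → ∀ x y → pow (x + y) q ≈ pow x q + pow y q
  freshman's-dream {zero} 0-prime _ _ _ with () ← ℕ.nonTrivial⇒n>1 0 {{prime⇒nonTrivial 0-prime}}
  freshman's-dream {suc p′} q-prime q·≈0 x y = begin
    pow (x + y) (suc p′)  ≈⟨ pow≈^ (x + y) (suc p′) ⟩
    (x + y) ^ suc p′      ≈⟨ theorem (suc p′) x y ⟩
    sum T                 ≈⟨ +-congˡ (sum-init-last (λ i → T (Fin.suc i))) ⟩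
    T Fin.zero + (sum (λ i → T (Fin.suc (inject₁ i))) + T (Fin.suc (fromℕ p′)))
                          ≈⟨ +-cong first (+-cong (sum-zero _ middle) last) ⟩
    pow y (suc p′) + (0# + pow x (suc p′)) ≈⟨ trans (+-congˡ (+-identityˡ _)) (+-comm _ _) ⟩
    pow x (suc p′) + pow y (suc p′) ∎
    where
    T = binomialTerm x y (suc p′)
    first : T Fin.zero ≈ pow y (suc p′)
    first = trans (+-identityʳ _) (trans (*-identityˡ _) (sym (pow≈^ y (suc p′))))
    last : T (Fin.suc (fromℕ p′)) ≈ pow x (suc p′)
    last = begin
      T (Fin.suc (fromℕ p′))
        ≡⟨ ≡.cong (λ j → (suc p′ C j) · (x ^ j * y ^ (suc p′ ℕ.∸ j))) (≡.cong suc (Fin.toℕ-fromℕ p′)) ⟩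
      (suc p′ C suc p′) · (x ^ suc p′ * y ^ (suc p′ ℕ.∸ suc p′))
        ≡⟨ ≡.cong₂ (λ a b → a · (x ^ suc p′ * y ^ b)) (nCn≡1 (suc p′)) (ℕ.n∸n≡0 p′) ⟩
      1 · (x ^ suc p′ * 1#) ≈⟨ trans (+-identityʳ _) (*-identityʳ _) ⟩
      x ^ suc p′            ≈⟨ pow≈^ x (suc p′) ⟨
      pow x (suc p′)        ∎
    middle : ∀ i → T (Fin.suc (inject₁ i)) ≈ 0#
    middle i with prime∣pCk q-prime (s≤s z≤n) (s≤s (≡.subst (ℕ._< p′) (≡.sym (Fin.toℕ-inject₁ i)) (Fin.toℕ<n i)))
    ... | divides r pCj≡r*p = begin
      (suc p′ C suc j) · B  ≡⟨ ≡.cong (_· B) pCj≡r*p ⟩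
      (r ℕ.* suc p′) · B    ≈⟨ ×-assocˡ B r (suc p′) ⟨
      r · (suc p′ · B)      ≈⟨ ×-congʳ r (q·≈0 B) ⟩
      r · 0#                ≈⟨ m·0≈0 r ⟩
      0#                    ∎
      where
      j = toℕ (inject₁ i)
      B = x ^ suc j * y ^ (suc p′ ℕ.∸ suc j)

  module Characteristic (p : ℕ) (p-prime : Prime p) (e : ℕ) (n≡pᵉ : n ≡ p ℕ.^ e) where

    pᵏ·1≈pow : ∀ k → (p ℕ.^ k) · 1# ≈ pow (p · 1#) k
    pᵏ·1≈pow zero = +-identityʳ 1#
    pᵏ·1≈pow (suc k) = trans (×1-homo-* p (p ℕ.^ k)) (*-congˡ (pᵏ·1≈pow k))

    p·x≈0 : ∀ x → p · x ≈ 0#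
    p·x≈0 x = begin
      p · x          ≈⟨ ×-congʳ p (*-identityˡ x) ⟨
      p · (1# * x)   ≈⟨ ×-assoc-* p 1# x ⟨
      (p · 1#) * x   ≈⟨ *-congʳ p·1≈0 ⟩
      0# * x         ≈⟨ zeroˡ x ⟩
      0#             ∎
      where
      p·1≈0 : p · 1# ≈ 0#
      p·1≈0 = pow≈0⇒x≈0 e (trans (sym (pᵏ·1≈pow e)) (≡.subst (λ m → m · 1# ≈ 0#) n≡pᵉ (n·x≈0 1#)))

    freshman's-dream-pow : ∀ j x y → pow (x + y) (p ℕ.^ j) ≈ pow x (p ℕ.^ j) + pow y (p ℕ.^ j)
    freshman's-dream-pow zero x y = trans (*-identityʳ _) (sym (+-cong (*-identityʳ x) (*-identityʳ y)))
    freshman's-dream-pow (suc j) x y = begin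
      pow (x + y) (p ℕ.* p ℕ.^ j)                  ≈⟨ pow-*-assoc (x + y) p (p ℕ.^ j) ⟩
      pow (pow (x + y) p) (p ℕ.^ j)                ≈⟨ pow-cong (p ℕ.^ j) (freshman's-dream p-prime p·x≈0 x y) ⟩
      pow (pow x p + pow y p) (p ℕ.^ j)            ≈⟨ freshman's-dream-pow j _ _ ⟩
      pow (pow x p) (p ℕ.^ j) + pow (pow y p) (p ℕ.^ j) ≈⟨ +-cong (pow-*-assoc x p _) (pow-*-assoc y p _) ⟨
      pow x (p ℕ.* p ℕ.^ j) + pow y (p ℕ.* p ℕ.^ j) ∎

module Tuples {a ℓ} (S : Setoid a ℓ) where

  open import Defs using (allTuples)
  open import Data.Nat using (zero; suc; _*_; _^_)
  open import Data.List using (List; []; _∷_; length; map; concatMap)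
  import Data.List.Properties as List
  open import Data.List.Relation.Unary.Any using (Any; here; there)
  import Data.List.Relation.Unary.Any as Any
  import Data.List.Relation.Unary.Any.Properties as Any
  open import Data.List.Relation.Unary.All using (All; []; _∷_)
  import Data.List.Relation.Unary.All as All
  import Data.List.Relation.Unary.All.Properties as All
  open import Data.List.Relation.Unary.AllPairs using (AllPairs; []; _∷_)
  import Data.List.Relation.Unary.AllPairs as AllPairs
  import Data.List.Relation.Unary.AllPairs.Properties as AllPairs
  open import Data.Vec using (Vec; []; _∷_; head)
  import Data.Vec.Relation.Unary.All as Vec
  open import Data.Vec.Relation.Binary.Pointwise.Inductive as Pointwise using (Pointwise; []; _∷_)
  open import Relation.Binary.PropositionalEquality as ≡ using (_≡_)
  open import Relation.Nullary using (¬_)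

  open Setoid S renaming (Carrier to A)
  open import Data.List.Membership.Setoid S using (_∈_)
  open import Data.List.Relation.Unary.Unique.Setoid S using (Unique)

  private
    consAll : ∀ {k} → List A → List A → List (Vec A (suc k))
    consAll {k} xs ys = concatMap (λ x → map (x ∷_) (allTuples xs k)) ys

  length-allTuples : ∀ xs k → length (allTuples xs k) ≡ length xs ^ k
  length-allTuples xs zero = ≡.refl
  length-allTuples xs (suc k) = go xs
    where
    go : ∀ ys → length (consAll {k} xs ys) ≡ length ys * length xs ^ k
    go [] = ≡.refl
    go (y ∷ ys) = ≡.trans (List.length-++ (map (y ∷_) (allTuples xs k)))
      (≡.cong₂ _+_ (≡.trans (List.length-map (y ∷_) (allTuples xs k)) (length-allTuples xs k)) (go ys))
      where open Data.Nat using (_+_)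

  allTuples-entries : ∀ xs k → All (Vec.All (_∈ xs)) (allTuples xs k)
  allTuples-entries xs zero = Vec.[] ∷ []
  allTuples-entries xs (suc k) = go xs (λ y∈ → y∈)
    where
    go : ∀ ys → (∀ {y} → y ∈ ys → y ∈ xs) → All (Vec.All (_∈ xs)) (consAll {k} xs ys)
    go [] _ = []
    go (y ∷ ys) ys⊆xs = All.++⁺ (All.map⁺ (All.map (ys⊆xs (here refl) Vec.∷_) (allTuples-entries xs k)))
                                (go ys (ys⊆xs ∘ there))
      where open import Function using (_∘_)

  allTuples-complete : ∀ xs {k} (cs : Vec A k) → Vec.All (_∈ xs) cs → Any (Pointwise _≈_ cs) (allTuples xs k)
  allTuples-complete xs [] Vec.[] = here []
  allTuples-complete xs {suc k} (c ∷ cs) (c∈ Vec.∷ cs∈) = go xs c∈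
    where
    go : ∀ ys → c ∈ ys → Any (Pointwise _≈_ (c ∷ cs)) (consAll {k} xs ys)
    go (y ∷ ys) (here c≈y) = Any.++⁺ˡ (Any.map⁺ (Any.map (c≈y ∷_) (allTuples-complete xs cs cs∈)))
    go (y ∷ ys) (there c∈ys) = Any.++⁺ʳ (map (y ∷_) (allTuples xs k)) (go ys c∈ys)

  allTuples-unique : ∀ {xs} → Unique xs → ∀ k → AllPairs (λ s t → ¬ Pointwise _≈_ s t) (allTuples xs k)
  allTuples-unique u zero = [] ∷ []
  allTuples-unique {xs} u (suc k) = go xs u
    where
    heads∈ : ∀ ys → All (λ s → Any (head s ≡_) ys) (consAll {k} xs ys)
    heads∈ [] = []
    heads∈ (y ∷ ys) = All.++⁺ (All.map⁺ (All.universal (λ _ → here ≡.refl) (allTuples xs k))) (All.map there (heads∈ ys))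
    go : ∀ ys → Unique ys → AllPairs (λ s t → ¬ Pointwise _≈_ s t) (consAll {k} xs ys)
    go [] _ = []
    go (y ∷ ys) (y≉ys ∷ u′) = AllPairs.++⁺
      (AllPairs.map⁺ (AllPairs.map (λ s≉t y∷s≋y∷t → s≉t (Pointwise.tail y∷s≋y∷t)) (allTuples-unique u k)))
      (go ys u′)
      (All.map⁺ (All.universal (λ _ → All.map different-heads (heads∈ ys)) _))
      where
      y≉ : ∀ {zs h} → All (λ w → ¬ (y ≈ w)) zs → Any (h ≡_) zs → ¬ (y ≈ h)
      y≉ (y≉w ∷ _) (here ≡.refl) = y≉w
      y≉ (_ ∷ y≉zs) (there h∈) = y≉ y≉zs h∈
      different-heads : ∀ {t : Vec A k} {s} → Any (head s ≡_) ys → ¬ Pointwise _≈_ (y ∷ t) s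
      different-heads {s = _ ∷ _} h∈ (y≈h ∷ _) = y≉ y≉ys h∈ y≈h

-- q = q′ + 2 and v = v′ + 1, so that q ≥ 2 and v ≥ 1 hold by computation.
module GaloisField {c ℓ} (R : CommutativeRing c ℓ) (_≟_ : Decidable (CommutativeRing._≈_ R))
                   (isField : FF.IsField R _≟_)
                   (q′ p m : ℕ) (p-prime : Prime p) (q≡pᵐ : suc (suc q′) ≡ p ℕ.^ m) (v′ : ℕ)
                   (elems : List (CommutativeRing.Carrier R))
                   (enumeration : FF.FiniteEnumeration R _≟_ elems (suc (suc q′) ℕ.^ suc v′)) where

  open import Data.Nat using (zero; _^_; _≤_; _<_; z≤n; s≤s)
  import Data.Nat.Properties as ℕ
  open import Data.Product using (_×_; _,_; ∃; proj₁; proj₂)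
  open import Data.List using ([]; _∷_; length; filter; cartesianProduct; upTo)
  open import Data.List.Relation.Unary.Any using (Any; here; there; any?)
  import Data.List.Relation.Unary.Any as Any
  import Data.List.Relation.Unary.Any.Properties as Any
  open import Data.List.Relation.Unary.All using (All; []; _∷_)
  import Data.List.Relation.Unary.All as All
  import Data.List.Relation.Unary.All.Properties as All
  import Data.List.Properties as List
  open import Data.List.Relation.Unary.AllPairs as AllPairs using (AllPairs; []; _∷_)
  import Data.List.Relation.Unary.AllPairs.Properties as AllPairs
  import Data.List.Relation.Unary.Unique.Setoid.Properties as Unique
  open import Data.Vec as Vec using (Vec; []; _∷_)
  import Data.Vec.Relation.Unary.All as VecAll
  open VecAll using ([]; _∷_)
  open import Data.Vec.Relation.Binary.Pointwise.Inductive using (Pointwise; []; _∷_)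
  open import Relation.Nullary using (¬_; Dec; yes; no)
  open import Relation.Nullary.Decidable using (¬?; _×-dec_)
  open import Function using (_∘_)
  open import Data.Empty using (⊥; ⊥-elim)
  open import Data.Sum using (_⊎_; inj₁; inj₂)
  open import Level using (_⊔_)
  open import Data.Nat.Divisibility using (_∣_; ∣⇒≤)
  open import Data.Nat.Primality using (prime⇒irreducible)
  open import Relation.Binary.PropositionalEquality as ≡ using (_≡_)
  open import Data.Nat.Coprimality using (Coprime; coprime-Bézout)
  open import Data.Nat.GCD using (module Bézout)
  open Sums

  q v : ℕ
  q = suc (suc q′)
  v = suc v′

  open FiniteField R _≟_ isField elems (q ^ v) enumeration public
  open Characteristic p p-prime (m ℕ.* v) (≡.trans (≡.cong (_^ v) q≡pᵐ) (ℕ.^-*-assoc p m v)) public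
  open WithEnum elems q public
  open Tuples setoid
  import Relation.Binary.Reasoning.Setoid as SetoidReasoning
  module ≈-Reasoning = SetoidReasoning setoid

  qⁱ≡pᵐⁱ : ∀ i → q ^ i ≡ p ^ (m ℕ.* i)
  qⁱ≡pᵐⁱ i = ≡.trans (≡.cong (_^ i) q≡pᵐ) (ℕ.^-*-assoc p m i)

  frob-cong : ∀ i {x y} → x ≈ y → frob i x ≈ frob i y
  frob-cong i = pow-cong (q ^ i)

  frob-+ : ∀ i x y → frob i (x + y) ≈ frob i x + frob i y
  frob-+ i x y rewrite qⁱ≡pᵐⁱ i = freshman's-dream-pow (m ℕ.* i) x y

  frob-* : ∀ i x y → frob i (x * y) ≈ frob i x * frob i y
  frob-* i x y = pow-distribʳ-* x y (q ^ i)

  frob-0# : ∀ i → frob i 0# ≈ 0#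
  frob-0# i with q ^ i | ℕ.m^n>0 q i
  ... | suc _ | _ = zeroˡ _

  frob-‿ : ∀ i x → frob i (- x) ≈ - frob i x
  frob-‿ i x = +-cancelˡ (frob i x) _ _ (begin
    frob i x + frob i (- x) ≈⟨ frob-+ i x (- x) ⟨
    frob i (x - x)          ≈⟨ frob-cong i (-‿inverseʳ x) ⟩
    frob i 0#               ≈⟨ frob-0# i ⟩
    0#                      ≈⟨ -‿inverseʳ (frob i x) ⟨
    frob i x - frob i x     ∎)

    where open ≈-Reasoning

  frob-injective : ∀ i {x y} → frob i x ≈ frob i y → x ≈ y
  frob-injective i {x} {y} φx≈φy = x-y≈0⇒x≈y x y (pow≈0⇒x≈0 (q ^ i) (begin
    frob i (x - y)           ≈⟨ frob-+ i x (- y) ⟩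
    frob i x + frob i (- y)  ≈⟨ +-congˡ (frob-‿ i y) ⟩
    frob i x - frob i y      ≈⟨ x≈y⇒x-y≈0 φx≈φy ⟩
    0#                       ∎))

    where open ≈-Reasoning

  frob-∘ : ∀ i j x → frob i (frob j x) ≈ frob (j ℕ.+ i) x
  frob-∘ i j x = begin
    pow (pow x (q ^ j)) (q ^ i) ≈⟨ pow-*-assoc x (q ^ j) (q ^ i) ⟨
    pow x (q ^ j ℕ.* q ^ i)     ≡⟨ ≡.cong (pow x) (≡.sym (ℕ.^-distribˡ-+-* q j i)) ⟩
    pow x (q ^ (j ℕ.+ i))       ∎

    where open ≈-Reasoning

  frob-zero : ∀ x → frob 0 x ≈ x
  frob-zero = *-identityʳ

  frob-v : ∀ x → frob v x ≈ x
  frob-v = pow-n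

  frob-one : ∀ x → frob 1 x ≈ pow x q
  frob-one x = reflexive (≡.cong (pow x) (ℕ.*-identityʳ q))

  frob-∸ : ∀ {i} → i ≤ v → ∀ x → frob i (frob (v ℕ.∸ i) x) ≈ x
  frob-∸ {i} i≤v x = trans (frob-∘ i (v ℕ.∸ i) x) (trans (reflexive (≡.cong (λ k → frob k x) (ℕ.m∸n+n≡m i≤v))) (frob-v x))

  InFq-resp : ∀ {a b} → a ≈ b → InFq a → InFq b
  InFq-resp a≈b aᵠ≈a = trans (pow-cong q (sym a≈b)) (trans aᵠ≈a a≈b)

  frob-InFq : ∀ i {a} → InFq a → frob i a ≈ a
  frob-InFq zero _ = frob-zero _
  frob-InFq (suc i) {a} aᵠ≈a = begin
    pow a (q ℕ.* q ^ i)     ≈⟨ pow-*-assoc a q (q ^ i) ⟩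
    pow (pow a q) (q ^ i)   ≈⟨ pow-cong (q ^ i) aᵠ≈a ⟩
    pow a (q ^ i)           ≈⟨ frob-InFq i aᵠ≈a ⟩
    a                       ∎

    where open ≈-Reasoning

  InFq-+ : ∀ {a b} → InFq a → InFq b → InFq (a + b)
  InFq-+ {a} {b} a∈ b∈ = trans (sym (frob-one (a + b)))
    (trans (frob-+ 1 a b) (+-cong (trans (frob-one a) a∈) (trans (frob-one b) b∈)))

  InFq-* : ∀ {a b} → InFq a → InFq b → InFq (a * b)
  InFq-* a∈ b∈ = trans (pow-distribʳ-* _ _ q) (*-cong a∈ b∈)

  InFq-‿ : ∀ {a} → InFq a → InFq (- a)
  InFq-‿ {a} a∈ = trans (sym (frob-one (- a))) (trans (frob-‿ 1 a) (-‿cong (trans (frob-one a) a∈)))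

  InFq-0# : InFq 0#
  InFq-0# = trans (sym (frob-one 0#)) (frob-0# 1)

  InFq-1# : InFq 1#
  InFq-1# = pow-1# q

  InFq-inverse : ∀ {a b} → InFq a → a * b ≈ 1# → InFq b
  InFq-inverse {a} {b} a∈ ab≈1 = *-cancelˡ aᵠ≉0 (begin
    pow a q * pow b q ≈⟨ pow-distribʳ-* a b q ⟨
    pow (a * b) q     ≈⟨ pow-cong q ab≈1 ⟩
    pow 1# q          ≈⟨ pow-1# q ⟩
    1#                ≈⟨ ab≈1 ⟨
    a * b             ≈⟨ *-congʳ a∈ ⟨
    pow a q * b       ∎)
    where
    open ≈-Reasoning
    aᵠ≉0 : ¬ (pow a q ≈ 0#)
    aᵠ≉0 aᵠ≈0 = 1≉0 (trans (sym ab≈1) (trans (*-congʳ (trans (sym a∈) aᵠ≈0)) (zeroˡ b)))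

  InFq? = λ x → pow x q ≟ x

  Fq-unique : Unique Fq
  Fq-unique = Unique.filter⁺ setoid InFq? elems-unique

  InFq⇒∈Fq : ∀ {a} → InFq a → a ∈ Fq
  InFq⇒∈Fq a∈ = ∈-filter⁺ setoid InFq? InFq-resp (∈-elems _) a∈

  ∈Fq⇒InFq : ∀ {a} → a ∈ Fq → InFq a
  ∈Fq⇒InFq a∈ = proj₂ (∈-filter⁻ setoid InFq? InFq-resp {xs = elems} a∈)

  All-InFq-Fq : All InFq Fq
  All-InFq-Fq = All.all-filter InFq? elems

  -- The elements of F_q are roots of x^q - x.
  length-Fq≤q : length Fq ≤ q
  length-Fq≤q = Monic-roots≤degree q xᵠ-x-monic Fq Fq-unique (All.map x≈y⇒x-y≈0 All-InFq-Fq)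
    where
    xᵠ-x-monic : Monic q (λ x → pow x q - x)
    xᵠ-x-monic = (λ x → pow x (suc q′) - 1#) , 0# , Monic-subtract q′ (pow-monic (suc q′)) 1# ,
      (λ x → sym (trans (+-identityʳ _) (trans (x[y-z]≈xy-xz x _ 1#) (+-congˡ (-‿cong (*-identityʳ x))))))

  trace : ℕ → Carrier → Carrier
  trace zero x = 0#
  trace (suc n) x = trace n x + frob n x

  trace-InFq : ∀ x → InFq (trace v x)
  trace-InFq x = trans (sym (frob-one _)) (+-cancelʳ x _ _ (trans (frob-trace v) (+-congˡ (frob-v x))))
    where
    open ≈-Reasoning
    frob-trace : ∀ n → frob 1 (trace n x) + x ≈ trace n x + frob n x
    frob-trace zero = trans (+-congʳ (frob-0# 1)) (+-congˡ (sym (frob-zero x)))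
    frob-trace (suc n) = begin
      frob 1 (trace n x + frob n x) + x                ≈⟨ +-congʳ (frob-+ 1 _ _) ⟩
      (frob 1 (trace n x) + frob 1 (frob n x)) + x     ≈⟨ solve 3 (λ a b c → (a :+ b) :+ c := (a :+ c) :+ b) refl _ _ _ ⟩
      (frob 1 (trace n x) + x) + frob 1 (frob n x)     ≈⟨ +-cong (frob-trace n) (frob-∘ 1 n x) ⟩
      (trace n x + frob n x) + frob (n ℕ.+ 1) x        ≡⟨ ≡.cong (λ k → (trace n x + frob n x) + frob k x) (ℕ.+-comm n 1) ⟩
      trace (suc n) x + frob (suc n) x                 ∎

  trace-monic : ∀ n → Monic (q ^ n) (trace (suc n))
  trace-monic zero = Monic-cong 1 (pow-monic 1) (λ _ → +-identityˡ _)
  trace-monic (suc n) = Monic-cong (q ^ suc n)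
    (Monic-+-lower (q ^ suc n) (q ^ n) (pow-monic (q ^ suc n)) (trace-monic n) (ℕ.^-monoʳ-< q (s≤s (s≤s z≤n)) (ℕ.n<1+n n)))
    (λ _ → +-comm _ _)

  trace-fibre≤ : ∀ t → length (filter (λ x → trace v x ≟ t) elems) ≤ q ^ v′
  trace-fibre≤ t = Monic-roots≤degree (q ^ v′) (trace-minus-monic (q ^ v′) ≡.refl)
    (filter (λ x → trace v x ≟ t) elems) (Unique.filter⁺ setoid _ elems-unique)
    (All.map x≈y⇒x-y≈0 (All.all-filter (λ x → trace v x ≟ t) elems))
    where
    trace-minus-monic : ∀ d → q ^ v′ ≡ d → Monic d (λ x → trace v x - t)
    trace-minus-monic (suc d) qᵛ′≡1+d = Monic-subtract d (≡.subst (λ e → Monic e (trace v)) qᵛ′≡1+d (trace-monic v′)) t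
    trace-minus-monic zero qᵛ′≡0 = ⊥-elim (ℕ.<⇒≢ (ℕ.m^n>0 q v′) (≡.sym qᵛ′≡0))

  -- The trace maps the q^v elements into F_q with fibres of size at most q^(v-1).
  length-Fq≡q : length Fq ≡ q
  length-Fq≡q = ℕ.≤-antisym length-Fq≤q (ℕ.*-cancelʳ-≤ q (length Fq) (q ^ v′) {{ℕ.>-nonZero (ℕ.m^n>0 q v′)}} (begin
    q ^ v                                                ≡⟨ ≡.trans (≡.sym length-elems) (≡.sym (≡.trans (∑-const elems 1) (ℕ.*-identityʳ _))) ⟩
    ∑[ x ∈ elems ] 1                                     ≤⟨ ∑-mono-≤ elems (λ x → 1≤∑𝟙≈ Fq (InFq⇒∈Fq (trace-InFq x))) ⟩
    ∑[ x ∈ elems ] ∑[ t ∈ Fq ] 𝟙 (trace v x ≟ t)         ≡⟨ ∑-comm elems Fq _ ⟩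
    ∑[ t ∈ Fq ] ∑[ x ∈ elems ] 𝟙 (trace v x ≟ t)         ≡⟨ ∑-cong Fq (λ t → ≡.sym (length-filter≡∑𝟙 (λ x → trace v x ≟ t) elems)) ⟩
    ∑[ t ∈ Fq ] length (filter (λ x → trace v x ≟ t) elems) ≤⟨ ∑-mono-≤ Fq trace-fibre≤ ⟩
    ∑[ t ∈ Fq ] (q ^ v′)                                 ≡⟨ ∑-const Fq _ ⟩
    length Fq ℕ.* q ^ v′                                 ∎))
    where
    open ℕ.≤-Reasoning
    1≤∑𝟙≈ : ∀ {z} ts → z ∈ ts → 1 ≤ ∑[ t ∈ ts ] 𝟙 (z ≟ t)
    1≤∑𝟙≈ {z} (t ∷ ts) (here z≈t) rewrite 𝟙-yes (z ≟ t) z≈t = s≤s z≤n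
    1≤∑𝟙≈ (t ∷ ts) (there z∈ts) = ℕ.≤-trans (1≤∑𝟙≈ ts z∈ts) (ℕ.m≤n+m _ _)

  InFq* : Carrier → Set _
  InFq* a = InFq a × ¬ (a ≈ 0#)

  InFq*-1# : InFq* 1#
  InFq*-1# = InFq-1# , 1≉0

  InFq*-* : ∀ {a b} → InFq* a → InFq* b → InFq* (a * b)
  InFq*-* (a∈ , a≉0) (b∈ , b≉0) = InFq-* a∈ b∈ , *-nonzero a≉0 b≉0

  InFq*-inverse : ∀ {a} → InFq* a → ∃ λ b → InFq* b × a * b ≈ 1#
  InFq*-inverse {a} (a∈ , a≉0) with inverse a a≉0
  ... | b , ab≈1 = b , (InFq-inverse a∈ ab≈1 , λ b≈0 → 1≉0 (trans (sym ab≈1) (trans (*-congˡ b≈0) (zeroʳ a)))) , ab≈1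

  ∼⇒scalar : ∀ {x y} → x ∼ y → ∃ λ a → InFq* a × x ≈ a * y
  ∼⇒scalar x∼y with find x∼y
    where open import Data.List.Membership.Setoid setoid using (find)
  ... | a , a∈Fq , a≉0 , x≈ay = a , (∈Fq⇒InFq a∈Fq , a≉0) , x≈ay

  scalar⇒∼ : ∀ {x y a} → InFq* a → x ≈ a * y → x ∼ y
  scalar⇒∼ {x} {y} {a} (a∈ , a≉0) x≈ay = Any.map (λ a≈b → (λ b≈0 → a≉0 (trans a≈b b≈0)) , trans x≈ay (*-congʳ a≈b)) (InFq⇒∈Fq a∈)

  ∼-sym : ∀ {x y} → x ∼ y → y ∼ x
  ∼-sym {x} {y} x∼y with ∼⇒scalar x∼y
  ... | a , a∈ , x≈ay with InFq*-inverse a∈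
  ... | b , b∈ , ab≈1 = scalar⇒∼ b∈ (begin
    y              ≈⟨ *-identityˡ y ⟨
    1# * y         ≈⟨ *-congʳ (trans (sym ab≈1) (*-comm a b)) ⟩
    (b * a) * y    ≈⟨ *-assoc b a y ⟩
    b * (a * y)    ≈⟨ *-congˡ x≈ay ⟨
    b * x          ∎)
    where open ≈-Reasoning

  ∼-trans : ∀ {x y z} → x ∼ y → y ∼ z → x ∼ z
  ∼-trans x∼y y∼z with ∼⇒scalar x∼y | ∼⇒scalar y∼z
  ... | a , a∈ , x≈ay | b , b∈ , y≈bz = scalar⇒∼ (InFq*-* a∈ b∈) (trans x≈ay (trans (*-congˡ y≈bz) (sym (*-assoc _ _ _))))

  ∼-resp-≈ : ∀ {x x′ y y′} → x ≈ x′ → y ≈ y′ → x ∼ y → x′ ∼ y′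
  ∼-resp-≈ x≈x′ y≈y′ x∼y with ∼⇒scalar x∼y
  ... | a , a∈ , x≈ay = scalar⇒∼ a∈ (trans (sym x≈x′) (trans x≈ay (*-congˡ y≈y′)))

  ∼-*-cancelʳ : ∀ {x y w} → ¬ (w ≈ 0#) → (x * w) ∼ (y * w) → x ∼ y
  ∼-*-cancelʳ {x} {y} {w} w≉0 xw∼yw with ∼⇒scalar xw∼yw
  ... | a , a∈ , xw≈ayw = scalar⇒∼ a∈ (*-cancelˡ w≉0 (trans (*-comm w x)
    (trans xw≈ayw (solve 3 (λ a y w → a :* (y :* w) := w :* (a :* y)) refl a y w))))

  ∼-*-congˡ : ∀ {x y} w → x ∼ y → (w * x) ∼ (w * y)
  ∼-*-congˡ {x} {y} w x∼y with ∼⇒scalar x∼y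
  ... | a , a∈ , x≈ay = scalar⇒∼ a∈ (trans (*-congˡ x≈ay) (solve 3 (λ w a y → w :* (a :* y) := a :* (w :* y)) refl w a y))

  ∼-nonzero : ∀ {x y} → ¬ (y ≈ 0#) → x ∼ y → ¬ (x ≈ 0#)
  ∼-nonzero y≉0 x∼y x≈0 with ∼⇒scalar x∼y
  ... | a , (_ , a≉0) , x≈ay = *-nonzero a≉0 y≉0 (trans (sym x≈ay) x≈0)

  frob-∼ : ∀ i {x y} → x ∼ y → frob i x ∼ frob i y
  frob-∼ i x∼y with ∼⇒scalar x∼y
  ... | a , a∈ , x≈ay = scalar⇒∼ a∈ (trans (frob-cong i x≈ay) (trans (frob-* i a _) (*-congʳ (frob-InFq i (proj₁ a∈)))))

  frob-∼⁻ : ∀ i {x y} → frob i x ∼ frob i y → x ∼ y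
  frob-∼⁻ i φx∼φy with ∼⇒scalar φx∼φy
  ... | a , a∈ , φx≈aφy = scalar⇒∼ a∈ (frob-injective i
    (trans φx≈aφy (trans (*-congʳ (sym (frob-InFq i (proj₁ a∈)))) (sym (frob-* i a _)))))

  lincomb-cong : ∀ {k} {cs ds : Vec Carrier k} (bs : Vec Carrier k) → Pointwise _≈_ cs ds → lincomb cs bs ≈ lincomb ds bs
  lincomb-cong [] [] = refl
  lincomb-cong (b ∷ bs) (c≈d ∷ cs≈ds) = +-cong (*-congʳ c≈d) (lincomb-cong bs cs≈ds)

  lincomb-∸ : ∀ {k} (cs ds bs : Vec Carrier k) → lincomb cs bs - lincomb ds bs ≈ lincomb (Vec.zipWith _-_ cs ds) bs
  lincomb-∸ [] [] [] = -‿inverseʳ 0#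
  lincomb-∸ (c ∷ cs) (d ∷ ds) (b ∷ bs) = begin
    (c * b + lincomb cs bs) - (d * b + lincomb ds bs)        ≈⟨ +-congˡ (-‿+-comm _ _) ⟨
    (c * b + lincomb cs bs) + (- (d * b) + - lincomb ds bs)  ≈⟨ solve 4 (λ a b c d → (a :+ b) :+ (c :+ d) := (a :+ c) :+ (b :+ d)) refl _ _ _ _ ⟩
    (c * b + - (d * b)) + (lincomb cs bs - lincomb ds bs)    ≈⟨ +-cong (trans (+-congˡ (-‿distribˡ-* d b)) (sym (distribʳ b c (- d)))) (lincomb-∸ cs ds bs) ⟩
    (c - d) * b + lincomb (Vec.zipWith _-_ cs ds) bs         ∎
    where open ≈-Reasoning

  lincomb-scale : ∀ {k} a (cs bs : Vec Carrier k) → a * lincomb cs bs ≈ lincomb (Vec.map (a *_) cs) bs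
  lincomb-scale a [] [] = zeroʳ a
  lincomb-scale a (c ∷ cs) (b ∷ bs) = trans (distribˡ a _ _) (+-cong (sym (*-assoc a c b)) (lincomb-scale a cs bs))

  lincomb-zeros : ∀ {k} (bs : Vec Carrier k) → lincomb (Vec.replicate k 0#) bs ≈ 0#
  lincomb-zeros [] = refl
  lincomb-zeros (b ∷ bs) = trans (+-cong (zeroˡ b) (lincomb-zeros bs)) (+-identityˡ 0#)

  lincomb-frob : ∀ {k} i {cs : Vec Carrier k} (bs : Vec Carrier k) → VecAll.All InFq cs →
                 lincomb cs (Vec.map (frob i) bs) ≈ frob i (lincomb cs bs)
  lincomb-frob i [] [] = sym (frob-0# i)
  lincomb-frob i {c ∷ cs} (b ∷ bs) (c∈ ∷ cs∈) = begin
    c * frob i b + lincomb cs (Vec.map (frob i) bs) ≈⟨ +-cong (*-congʳ (sym (frob-InFq i c∈))) (lincomb-frob i bs cs∈) ⟩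
    frob i c * frob i b + frob i (lincomb cs bs)    ≈⟨ +-congʳ (frob-* i c b) ⟨
    frob i (c * b) + frob i (lincomb cs bs)         ≈⟨ frob-+ i _ _ ⟨
    frob i (c * b + lincomb cs bs)                  ∎
    where open ≈-Reasoning

  lincomb-injective : ∀ {k} {bs : Vec Carrier k} → LinIndep bs → ∀ {cs ds} → VecAll.All InFq cs → VecAll.All InFq ds →
                      lincomb cs bs ≈ lincomb ds bs → Pointwise _≈_ cs ds
  lincomb-injective {bs = bs} independent {cs} {ds} cs∈ ds∈ eq =
    differences≈0 cs ds (independent _ (InFq-zipWith-∸ cs∈ ds∈) (trans (sym (lincomb-∸ cs ds bs)) (x≈y⇒x-y≈0 eq)))
    where
    InFq-zipWith-∸ : ∀ {k} {cs ds : Vec Carrier k} → VecAll.All InFq cs → VecAll.All InFq ds → VecAll.All InFq (Vec.zipWith _-_ cs ds)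
    InFq-zipWith-∸ [] [] = []
    InFq-zipWith-∸ (c∈ ∷ cs∈) (d∈ ∷ ds∈) = InFq-+ c∈ (InFq-‿ d∈) ∷ InFq-zipWith-∸ cs∈ ds∈
    differences≈0 : ∀ {k} (cs ds : Vec Carrier k) → VecAll.All (_≈ 0#) (Vec.zipWith _-_ cs ds) → Pointwise _≈_ cs ds
    differences≈0 [] [] [] = []
    differences≈0 (c ∷ cs) (d ∷ ds) (c-d≈0 ∷ rest) = x-y≈0⇒x≈y c d c-d≈0 ∷ differences≈0 cs ds rest

  length-span : ∀ {k} (bs : Vec Carrier k) → length (span bs) ≡ q ^ k
  length-span {k} bs = ≡.trans (List.length-map _ (allTuples Fq k))
    (≡.trans (length-allTuples Fq k) (≡.cong (_^ k) length-Fq≡q))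

  span-unique : ∀ {k} {bs : Vec Carrier k} → LinIndep bs → Unique (span bs)
  span-unique {k} independent = AllPairs.map⁺ (pairwise (allTuples-entries Fq k) (allTuples-unique Fq-unique k))
    where
    pairwise : ∀ {ts} → All (VecAll.All (_∈ Fq)) ts → AllPairs (λ s t → ¬ Pointwise _≈_ s t) ts →
               AllPairs (λ s t → ¬ (lincomb s _ ≈ lincomb t _)) ts
    pairwise [] [] = []
    pairwise (s∈ ∷ ts∈) (s≉ ∷ distinct) =
      All.zipWith (λ (t∈ , s≉t) eq → s≉t (lincomb-injective independent (VecAll.map ∈Fq⇒InFq s∈) (VecAll.map ∈Fq⇒InFq t∈) eq)) (ts∈ , s≉)
      ∷ pairwise ts∈ distinct

  lincomb∈span : ∀ {k} (bs : Vec Carrier k) {cs} → VecAll.All InFq cs → lincomb cs bs ∈ span bs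
  lincomb∈span {k} bs {cs} cs∈ = Any.map⁺ (Any.map (lincomb-cong bs) (allTuples-complete Fq cs (VecAll.map InFq⇒∈Fq cs∈)))

  ∈span⇒lincomb : ∀ {k} (bs : Vec Carrier k) {x} → x ∈ span bs → ∃ λ cs → VecAll.All InFq cs × x ≈ lincomb cs bs
  ∈span⇒lincomb {k} bs x∈ = Any.lookup found , VecAll.map ∈Fq⇒InFq (proj₁ entries) , proj₂ entries
    where
    found = Any.map⁻ x∈
    entries = All.lookupAny (allTuples-entries Fq k) found

  span-scale : ∀ {k} (bs : Vec Carrier k) {a x} → InFq a → x ∈ span bs → (a * x) ∈ span bs
  span-scale bs {a} a∈ x∈ with ∈span⇒lincomb bs x∈
  ... | cs , cs∈ , x≈ = ∈-resp-≈ setoid (sym (trans (*-congˡ x≈) (lincomb-scale a cs bs))) (lincomb∈span bs (VecAllProperties.map⁺ (VecAll.map (InFq-* a∈) cs∈)))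
    where import Data.Vec.Relation.Unary.All.Properties as VecAllProperties

  0#∈span : ∀ {k} (bs : Vec Carrier k) → 0# ∈ span bs
  0#∈span {k} bs = ∈-resp-≈ setoid (lincomb-zeros bs) (lincomb∈span bs (zeros-InFq k))
    where
    zeros-InFq : ∀ k → VecAll.All InFq (Vec.replicate k 0#)
    zeros-InFq zero = []
    zeros-InFq (suc k) = InFq-0# ∷ zeros-InFq k

  frob-LinIndep : ∀ {k} i {bs : Vec Carrier k} → LinIndep bs → LinIndep (Vec.map (frob i) bs)
  frob-LinIndep i {bs} independent cs cs∈ φ-comb≈0 =
    independent cs cs∈ (frob-injective i (trans (sym (lincomb-frob i bs cs∈)) (trans φ-comb≈0 (sym (frob-0# i)))))

  length-nonzero-Fq : length (filter nonzero? Fq) ≡ suc q′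
  length-nonzero-Fq = ℕ.suc-injective (≡.trans (length-filter-≉ 0# Fq-unique (InFq⇒∈Fq InFq-0#)) length-Fq≡q)

  ∑𝟙∼≡q-1 : ∀ {L} → Unique L → ∀ {y} → ¬ (y ≈ 0#) → (∀ {a} → InFq a → (a * y) ∈ L) →
            ∑[ x ∈ L ] 𝟙 (x ∼? y) ≡ suc q′
  ∑𝟙∼≡q-1 {L} L-unique {y} y≉0 scaled∈L = begin
    ∑[ x ∈ L ] 𝟙 (x ∼? y)                                      ≡⟨ ∑-cong L (λ x → 𝟙-any (λ a → nonzero? a ×-dec (x ≟ (a * y))) (at-most-one x)) ⟩
    ∑[ x ∈ L ] ∑[ a ∈ Fq ] 𝟙 (nonzero? a ×-dec (x ≟ (a * y)))  ≡⟨ ∑-comm L Fq _ ⟩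
    ∑[ a ∈ Fq ] ∑[ x ∈ L ] 𝟙 (nonzero? a ×-dec (x ≟ (a * y)))  ≡⟨ ∑-cong Fq (λ a → ∑-cong L (λ x → 𝟙-× (nonzero? a) (x ≟ (a * y)))) ⟩
    ∑[ a ∈ Fq ] ∑[ x ∈ L ] (𝟙 (nonzero? a) ℕ.* 𝟙 (x ≟ (a * y))) ≡⟨ ∑-cong Fq (λ a → ∑-*ˡ L (𝟙 (nonzero? a)) _) ⟩
    ∑[ a ∈ Fq ] (𝟙 (nonzero? a) ℕ.* ∑[ x ∈ L ] 𝟙 (x ≟ (a * y))) ≡⟨ ∑-cong-All (All.map (λ a∈ → ≡.cong (𝟙 (nonzero? _) ℕ.*_) (once a∈)) All-InFq-Fq) ⟩
    ∑[ a ∈ Fq ] (𝟙 (nonzero? a) ℕ.* 1)                         ≡⟨ ∑-cong Fq (λ a → ℕ.*-identityʳ _) ⟩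
    ∑[ a ∈ Fq ] 𝟙 (nonzero? a)                                 ≡⟨ length-filter≡∑𝟙 nonzero? Fq ⟨
    length (filter nonzero? Fq)                                ≡⟨ length-nonzero-Fq ⟩
    suc q′                                                     ∎
    where
    open ≡.≡-Reasoning
    at-most-one : ∀ x → AllPairs (λ a b → (¬ (a ≈ 0#)) × (x ≈ a * y) → (¬ (b ≈ 0#)) × (x ≈ b * y) → ⊥) Fq
    at-most-one x = AllPairs.map (λ a≉b (_ , x≈ay) (_ , x≈by) →
      a≉b (*-cancelˡ y≉0 (trans (*-comm y _) (trans (sym x≈ay) (trans x≈by (*-comm _ y)))))) Fq-unique
    once : ∀ {a} → InFq a → ∑[ x ∈ L ] 𝟙 (x ≟ (a * y)) ≡ 1
    once a∈ = ≡.trans (≡.sym (length-filter≡∑𝟙 (_≟ _) L)) (length-filter-≈ _ L-unique (scaled∈L a∈))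

  differences? : ∀ z x y → Dec (PairOK (x , y) × (x ∼ (z * y)))
  differences? z x y = PairOK? (x , y) ×-dec (x ∼? (z * y))

  diffCount≡∑∑ : ∀ {k} (B : Vec Carrier k) z →
                 diffCount B z ≡ ∑[ x ∈ span B ] ∑[ y ∈ span B ] 𝟙 (differences? z x y)
  diffCount≡∑∑ B z = ≡.trans (length-filter≡∑𝟙 _ (cartesianProduct (span B) (span B))) (∑-cartesianProduct (span B) (span B) _)

  ∑z𝟙∼≡q-1 : ∀ {x y} → PairOK (x , y) → ∑[ z ∈ elems ] 𝟙 (x ∼? (z * y)) ≡ suc q′
  ∑z𝟙∼≡q-1 {x} {y} (x≉0 , y≉0 , _) with inverse y y≉0
  ... | y⁻¹ , yy⁻¹≈1 = ≡.trans (∑-cong elems (λ z → 𝟙-⇔ (x ∼? (z * y)) (z ∼? w) to from))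
                               (∑𝟙∼≡q-1 elems-unique w≉0 (λ _ → ∈-elems _))
    where
    w = x * y⁻¹
    x≈wy : x ≈ w * y
    x≈wy = sym (trans (*-assoc x y⁻¹ y) (trans (*-congˡ (trans (*-comm y⁻¹ y) yy⁻¹≈1)) (*-identityʳ x)))
    w≉0 : ¬ (w ≈ 0#)
    w≉0 w≈0 = x≉0 (trans x≈wy (trans (*-congʳ w≈0) (zeroˡ y)))
    to : ∀ {z} → x ∼ (z * y) → z ∼ w
    to x∼zy = ∼-sym (∼-*-cancelʳ y≉0 (∼-resp-≈ x≈wy refl x∼zy))
    from : ∀ {z} → z ∼ w → x ∼ (z * y)
    from z∼w = ∼-sym (∼-resp-≈ (*-comm _ _) (trans (*-comm _ _) (sym x≈wy)) (∼-*-congˡ y z∼w))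

  module Block {k} (B : Vec Carrier k) (independent : LinIndep B) where

    S : List Carrier
    S = span B

    S* : ℕ
    S* = length (filter nonzero? S)

    suc-S*≡qᵏ : suc S* ≡ q ^ k
    suc-S*≡qᵏ = ≡.trans (length-filter-≉ 0# (span-unique independent) (0#∈span B)) (length-span B)

    -- Of the nonzero vectors of S, those representing the point [y] are exactly the q - 1 ones excluded.
    ∑x𝟙PairOK : ∀ {y} → y ∈ S → ∑[ x ∈ S ] 𝟙 (PairOK? (x , y)) ≡ 𝟙 (nonzero? y) ℕ.* (S* ℕ.∸ suc q′)
    ∑x𝟙PairOK {y} y∈S = by-cases (y ≟ 0#)
      where
      by-cases : (y≟0 : Dec (y ≈ 0#)) → ∑[ x ∈ S ] 𝟙 (PairOK? (x , y)) ≡ 𝟙 (¬? y≟0) ℕ.* (S* ℕ.∸ suc q′)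
      by-cases (yes y≈0) = ≡.trans (∑-cong S (λ x → 𝟙-no (PairOK? (x , y)) (λ (_ , y≉0 , _) → y≉0 y≈0))) (∑-0 S)
      by-cases (no y≉0) = ≡.trans (≡.sym (ℕ.m+n∸n≡m _ (suc q′))) (≡.trans (≡.cong (ℕ._∸ suc q′) split) (≡.sym (ℕ.+-identityʳ _)))
        where
        open ≡.≡-Reasoning
        OK+∼≡nonzero : ∀ x → 𝟙 (PairOK? (x , y)) ℕ.+ 𝟙 (x ∼? y) ≡ 𝟙 (nonzero? x)
        OK+∼≡nonzero x with x ≟ 0# | y ≟ 0# | x ∼? y
        ... | yes x≈0 | _       | yes x∼y = ⊥-elim (∼-nonzero y≉0 x∼y x≈0)
        ... | yes _   | _       | no _    = ≡.refl
        ... | no _    | yes y≈0 | _       = ⊥-elim (y≉0 y≈0)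
        ... | no _    | no _    | yes _   = ≡.refl
        ... | no _    | no _    | no _    = ≡.refl
        split : ∑[ x ∈ S ] 𝟙 (PairOK? (x , y)) ℕ.+ suc q′ ≡ S*
        split = begin
          ∑[ x ∈ S ] 𝟙 (PairOK? (x , y)) ℕ.+ suc q′                   ≡⟨ ≡.cong (∑[ x ∈ S ] 𝟙 (PairOK? (x , y)) ℕ.+_) (∑𝟙∼≡q-1 (span-unique independent) y≉0 (λ a∈ → span-scale B a∈ y∈S)) ⟨
          ∑[ x ∈ S ] 𝟙 (PairOK? (x , y)) ℕ.+ ∑[ x ∈ S ] 𝟙 (x ∼? y)   ≡⟨ ∑-+ S _ _ ⟨
          ∑[ x ∈ S ] (𝟙 (PairOK? (x , y)) ℕ.+ 𝟙 (x ∼? y))             ≡⟨ ∑-cong S OK+∼≡nonzero ⟩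
          ∑[ x ∈ S ] 𝟙 (nonzero? x)                                   ≡⟨ length-filter≡∑𝟙 nonzero? S ⟨
          S*                                                          ∎

    #pairs : ℕ
    #pairs = ∑[ x ∈ S ] ∑[ y ∈ S ] 𝟙 (PairOK? (x , y))

    #pairs≡ : #pairs ≡ (q ^ k ℕ.∸ 1) ℕ.* ((q ^ k ℕ.∸ 1) ℕ.∸ suc q′)
    #pairs≡ = begin
      ∑[ x ∈ S ] ∑[ y ∈ S ] 𝟙 (PairOK? (x , y))        ≡⟨ ∑-comm S S _ ⟩
      ∑[ y ∈ S ] ∑[ x ∈ S ] 𝟙 (PairOK? (x , y))        ≡⟨ ∑-cong-All (All.tabulateₛ setoid ∑x𝟙PairOK) ⟩
      ∑[ y ∈ S ] (𝟙 (nonzero? y) ℕ.* (S* ℕ.∸ suc q′))  ≡⟨ ∑-cong S (λ y → ℕ.*-comm _ (S* ℕ.∸ suc q′)) ⟩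
      ∑[ y ∈ S ] ((S* ℕ.∸ suc q′) ℕ.* 𝟙 (nonzero? y))  ≡⟨ ∑-*ˡ S (S* ℕ.∸ suc q′) (𝟙 ∘ nonzero?) ⟩
      (S* ℕ.∸ suc q′) ℕ.* ∑[ y ∈ S ] 𝟙 (nonzero? y)    ≡⟨ ≡.cong ((S* ℕ.∸ suc q′) ℕ.*_) (length-filter≡∑𝟙 nonzero? S) ⟨
      (S* ℕ.∸ suc q′) ℕ.* S*                           ≡⟨ ℕ.*-comm _ S* ⟩
      S* ℕ.* (S* ℕ.∸ suc q′)                           ≡⟨ ≡.cong (λ n → n ℕ.* (n ℕ.∸ suc q′)) (≡.cong (ℕ._∸ 1) suc-S*≡qᵏ) ⟩
      (q ^ k ℕ.∸ 1) ℕ.* ((q ^ k ℕ.∸ 1) ℕ.∸ suc q′)     ∎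
      where open ≡.≡-Reasoning

    ∑-diffCount : ∑[ z ∈ elems ] diffCount B z ≡ suc q′ ℕ.* #pairs
    ∑-diffCount = begin
      ∑[ z ∈ elems ] diffCount B z                                               ≡⟨ ∑-cong elems (diffCount≡∑∑ B) ⟩
      ∑[ z ∈ elems ] ∑[ x ∈ S ] ∑[ y ∈ S ] 𝟙 (differences? z x y)                ≡⟨ ∑-comm elems S _ ⟩
      ∑[ x ∈ S ] ∑[ z ∈ elems ] ∑[ y ∈ S ] 𝟙 (differences? z x y)                ≡⟨ ∑-cong S (λ x → ∑-comm elems S _) ⟩
      ∑[ x ∈ S ] ∑[ y ∈ S ] ∑[ z ∈ elems ] 𝟙 (differences? z x y)                ≡⟨ ∑-cong S (λ x → ∑-cong S (λ y → count-z x y)) ⟩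
      ∑[ x ∈ S ] ∑[ y ∈ S ] (suc q′ ℕ.* 𝟙 (PairOK? (x , y)))                     ≡⟨ ∑-cong S (λ x → ∑-*ˡ S (suc q′) _) ⟩
      ∑[ x ∈ S ] (suc q′ ℕ.* ∑[ y ∈ S ] 𝟙 (PairOK? (x , y)))                     ≡⟨ ∑-*ˡ S (suc q′) _ ⟩
      suc q′ ℕ.* #pairs                                                          ∎
      where
      open ≡.≡-Reasoning
      count-z : ∀ x y → ∑[ z ∈ elems ] 𝟙 (differences? z x y) ≡ suc q′ ℕ.* 𝟙 (PairOK? (x , y))
      count-z x y with PairOK? (x , y)
      ... | no _ = ≡.trans (∑-0 elems) (≡.sym (ℕ.*-zeroʳ (suc q′)))
      ... | yes ok = ≡.trans (∑-cong elems (λ z → ≡.trans (𝟙-× (yes ok) _) (ℕ.*-identityˡ _))) (≡.trans (∑z𝟙∼≡q-1 ok) (≡.sym (ℕ.*-identityʳ _)))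

  PairOK-resp-≈ : ∀ {x x′ y y′} → x ≈ x′ → y ≈ y′ → PairOK (x , y) → PairOK (x′ , y′)
  PairOK-resp-≈ x≈x′ y≈y′ (x≉0 , y≉0 , x≁y) =
    (λ x′≈0 → x≉0 (trans x≈x′ x′≈0)) , (λ y′≈0 → y≉0 (trans y≈y′ y′≈0)) , (λ x′∼y′ → x≁y (∼-resp-≈ (sym x≈x′) (sym y≈y′) x′∼y′))

  𝟙differences-resp-≈ : ∀ {z z′ x x′ y y′} → z ≈ z′ → x ≈ x′ → y ≈ y′ → 𝟙 (differences? z x y) ≡ 𝟙 (differences? z′ x′ y′)
  𝟙differences-resp-≈ z≈z′ x≈x′ y≈y′ = 𝟙-⇔ _ _
    (λ (ok , x∼zy) → PairOK-resp-≈ x≈x′ y≈y′ ok , ∼-resp-≈ x≈x′ (*-cong z≈z′ y≈y′) x∼zy)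
    (λ (ok , x∼zy) → PairOK-resp-≈ (sym x≈x′) (sym y≈y′) ok , ∼-resp-≈ (sym x≈x′) (*-cong (sym z≈z′) (sym y≈y′)) x∼zy)

  diffCount-resp-≈ : ∀ {k} (B : Vec Carrier k) {z z′} → z ≈ z′ → diffCount B z ≡ diffCount B z′
  diffCount-resp-≈ B {z} {z′} z≈z′ = ≡.trans (diffCount≡∑∑ B z)
    (≡.trans (∑-cong (span B) (λ x → ∑-cong (span B) (λ y → 𝟙differences-resp-≈ z≈z′ refl refl))) (≡.sym (diffCount≡∑∑ B z′)))

  ∑-span-frob : ∀ {k} i (B : Vec Carrier k) (G : Carrier → ℕ) → (∀ {a b} → a ≈ b → G a ≡ G b) →
                ∑ (span (Vec.map (frob i) B)) G ≡ ∑[ x ∈ span B ] G (frob i x)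
  ∑-span-frob {k} i B G G-resp =
    ≡.trans (∑-map _ (allTuples Fq k) G)
    (≡.trans (∑-cong-All (All.map (λ cs∈ → G-resp (lincomb-frob i B (VecAll.map ∈Fq⇒InFq cs∈))) (allTuples-entries Fq k)))
    (≡.sym (∑-map _ (allTuples Fq k) (G ∘ frob i))))

  differences-frob : ∀ i {z w} → frob i w ≈ z → ∀ x y → 𝟙 (differences? z (frob i x) (frob i y)) ≡ 𝟙 (differences? w x y)
  differences-frob i {z} {w} φw≈z x y = 𝟙-⇔ _ _
    (λ (ok , φx∼zφy) → PairOK-frob⁻ ok , frob-∼⁻ i (∼-resp-≈ refl (trans (*-congʳ (sym φw≈z)) (sym (frob-* i w y))) φx∼zφy))
    (λ (ok , x∼wy) → PairOK-frob⁺ ok , ∼-resp-≈ refl (trans (frob-* i w y) (*-congʳ φw≈z)) (frob-∼ i x∼wy))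
    where
    ≉0-frob⁺ : ∀ {a} → ¬ (a ≈ 0#) → ¬ (frob i a ≈ 0#)
    ≉0-frob⁺ a≉0 φa≈0 = a≉0 (frob-injective i (trans φa≈0 (sym (frob-0# i))))
    ≉0-frob⁻ : ∀ {a} → ¬ (frob i a ≈ 0#) → ¬ (a ≈ 0#)
    ≉0-frob⁻ φa≉0 a≈0 = φa≉0 (trans (frob-cong i a≈0) (frob-0# i))
    PairOK-frob⁺ : PairOK (x , y) → PairOK (frob i x , frob i y)
    PairOK-frob⁺ (x≉0 , y≉0 , x≁y) = ≉0-frob⁺ x≉0 , ≉0-frob⁺ y≉0 , (λ φx∼φy → x≁y (frob-∼⁻ i φx∼φy))
    PairOK-frob⁻ : PairOK (frob i x , frob i y) → PairOK (x , y)
    PairOK-frob⁻ (φx≉0 , φy≉0 , φx≁φy) = ≉0-frob⁻ φx≉0 , ≉0-frob⁻ φy≉0 , (λ x∼y → φx≁φy (frob-∼ i x∼y))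

  diffCount-frob : ∀ {k} (B : Vec Carrier k) {i} → i ≤ v → ∀ z → diffCount (Vec.map (frob i) B) z ≡ diffCount B (frob (v ℕ.∸ i) z)
  diffCount-frob {k} B {i} i≤v z = begin
    diffCount φB z                                                      ≡⟨ diffCount≡∑∑ φB z ⟩
    ∑[ x ∈ span φB ] ∑[ y ∈ span φB ] 𝟙 (differences? z x y)             ≡⟨ ∑-span-frob i B _ (λ x≈x′ → ∑-cong (span φB) (λ y → 𝟙differences-resp-≈ refl x≈x′ refl)) ⟩
    ∑[ x ∈ span B ] ∑[ y ∈ span φB ] 𝟙 (differences? z (frob i x) y)     ≡⟨ ∑-cong (span B) (λ x → ∑-span-frob i B _ (λ y≈y′ → 𝟙differences-resp-≈ refl refl y≈y′)) ⟩
    ∑[ x ∈ span B ] ∑[ y ∈ span B ] 𝟙 (differences? z (frob i x) (frob i y)) ≡⟨ ∑-cong (span B) (λ x → ∑-cong (span B) (differences-frob i (frob-∸ i≤v z) x)) ⟩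
    ∑[ x ∈ span B ] ∑[ y ∈ span B ] 𝟙 (differences? (frob (v ℕ.∸ i) z) x y) ≡⟨ diffCount≡∑∑ B _ ⟨
    diffCount B (frob (v ℕ.∸ i) z)                                      ∎
    where
    open ≡.≡-Reasoning
    φB = Vec.map (frob i) B

  ∑-frob : ∀ {i} → i ≤ v → (g : Carrier → ℕ) → (∀ {a b} → a ≈ b → g a ≡ g b) → ∑[ z ∈ elems ] g (frob i z) ≡ ∑ elems g
  ∑-frob {i} i≤v g g-resp = ≡.trans (≡.sym (fold≡∑ (g ∘ frob i) elems))
    (≡.trans (fold-∘-bijection g g-resp (frob i) (frob-cong i) (frob-injective i) elems-unique (λ _ → ∈-elems _)
                                 (λ {z} _ → frob (v ℕ.∸ i) z , ∈-elems _ , sym (frob-∸ i≤v z)))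
             (fold≡∑ g elems))
    where
    open UniqueFold setoid ℕ.+-0-commutativeMonoid
    fold≡∑ : ∀ (h : Carrier → ℕ) xs → fold h xs ≡ ∑ xs h
    fold≡∑ h [] = ≡.refl
    fold≡∑ h (x ∷ xs) = ≡.cong (h x ℕ.+_) (fold≡∑ h xs)

  NonIdentity? : (z : Carrier) → Dec (NonIdentity z)
  NonIdentity? z = nonzero? z ×-dec ¬? (InFq? z)

  length-NonIdentity+q : length (filter NonIdentity? elems) ℕ.+ q ≡ q ^ v
  length-NonIdentity+q = begin
    length (filter NonIdentity? elems) ℕ.+ q                  ≡⟨ ≡.cong₂ ℕ._+_ NonIdentity≡∉Fq (≡.sym length-Fq≡q) ⟩
    length (filter (¬? ∘ InFq?) elems) ℕ.+ length Fq          ≡⟨ ℕ.+-comm _ (length Fq) ⟩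
    length Fq ℕ.+ length (filter (¬? ∘ InFq?) elems)          ≡⟨ length-filter+length-filter¬ InFq? elems ⟩
    length elems                                              ≡⟨ length-elems ⟩
    q ^ v                                                     ∎
    where
    open ≡.≡-Reasoning
    NonIdentity≡∉Fq : length (filter NonIdentity? elems) ≡ length (filter (¬? ∘ InFq?) elems)
    NonIdentity≡∉Fq = ≡.trans (length-filter≡∑𝟙 NonIdentity? elems)
      (≡.trans (∑-cong elems (λ z → 𝟙-⇔ (NonIdentity? z) (¬? (InFq? z)) proj₂
                                       (λ z∉Fq → (λ z≈0 → z∉Fq (InFq-resp (sym z≈0) InFq-0#)) , z∉Fq)))
               (≡.sym (length-filter≡∑𝟙 (¬? ∘ InFq?) elems)))

  ¬NonIdentity⇒ : ∀ {z} → ¬ NonIdentity z → z ≈ 0# ⊎ InFq z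
  ¬NonIdentity⇒ {z} z≡1 with z ≟ 0# | InFq? z
  ... | yes z≈0 | _ = inj₁ z≈0
  ... | no _ | yes z∈Fq = inj₂ z∈Fq
  ... | no z≉0 | no z∉Fq = ⊥-elim (z≡1 (z≉0 , z∉Fq))

  frob-¬NonIdentity : ∀ i {z} → ¬ NonIdentity z → ¬ NonIdentity (frob i z)
  frob-¬NonIdentity i z≡1 (φz≉0 , φz∉Fq) with ¬NonIdentity⇒ z≡1
  ... | inj₁ z≈0 = φz≉0 (trans (frob-cong i z≈0) (frob-0# i))
  ... | inj₂ z∈Fq = φz∉Fq (InFq-resp (sym (frob-InFq i z∈Fq)) z∈Fq)

  identity-not-difference : ∀ {z x y} → ¬ NonIdentity z → PairOK (x , y) → ¬ (x ∼ (z * y))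
  identity-not-difference {z} {x} {y} z≡1 (x≉0 , y≉0 , x≁y) x∼zy with ∼⇒scalar x∼zy | ¬NonIdentity⇒ z≡1
  ... | a , a∈ , x≈azy | inj₁ z≈0 = x≉0 (trans x≈azy (trans (*-congˡ (trans (*-congʳ z≈0) (zeroˡ y))) (zeroʳ a)))
  ... | a , a∈ , x≈azy | inj₂ z∈Fq = x≁y (scalar⇒∼ (InFq*-* a∈ (z∈Fq , z≉0)) (trans x≈azy (sym (*-assoc a z y))))
    where
    z≉0 : ¬ (z ≈ 0#)
    z≉0 z≈0 = x≉0 (trans x≈azy (trans (*-congˡ (trans (*-congʳ z≈0) (zeroˡ y))) (zeroʳ a)))

  diffCount-identity : ∀ {k} (B : Vec Carrier k) {z} → ¬ NonIdentity z → diffCount B z ≡ 0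
  diffCount-identity B {z} z≡1 = ≡.trans (diffCount≡∑∑ B z)
    (≡.trans (∑-cong (span B) (λ x → ≡.trans (∑-cong (span B) (λ y → 𝟙-no (differences? z x y) λ (ok , x∼zy) → identity-not-difference z≡1 ok x∼zy)) (∑-0 (span B))))
             (∑-0 (span B)))

  orbit? : ∀ z x y → Dec (PairOK (x , y) × Any (λ i → x ∼ (frob i z * y)) (upTo v))
  orbit? z x y = PairOK? (x , y) ×-dec any? (λ i → x ∼? (frob i z * y)) (upTo v)

  orbitCount≡∑∑ : ∀ {k} (B : Vec Carrier k) z → orbitCount v B z ≡ ∑[ x ∈ span B ] ∑[ y ∈ span B ] 𝟙 (orbit? z x y)
  orbitCount≡∑∑ B z = ≡.trans (length-filter≡∑𝟙 _ (cartesianProduct (span B) (span B))) (∑-cartesianProduct (span B) (span B) _)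

  orbitCount-identity : ∀ {k} (B : Vec Carrier k) {z} → ¬ NonIdentity z → orbitCount v B z ≡ 0
  orbitCount-identity B {z} z≡1 = ≡.trans (orbitCount≡∑∑ B z)
    (≡.trans (∑-cong (span B) (λ x → ≡.trans (∑-cong (span B) (λ y → 𝟙-no (orbit? z x y) λ (ok , in-orbit) →
       let (i , x∼φⁱzy) = Any.satisfied in-orbit in identity-not-difference (frob-¬NonIdentity i z≡1) ok x∼φⁱzy)) (∑-0 (span B))))
             (∑-0 (span B)))

  module Orbits (v-prime : Prime v) (v∤q-1 : ¬ (v ∣ suc q′)) where

    Fixes : ℕ → Carrier → Set (c ⊔ ℓ)
    Fixes n z = ∃ λ a → InFq* a × frob n z ≈ a * z

    module _ {z : Carrier} where

      fixes-0 : Fixes 0 z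
      fixes-0 = 1# , InFq*-1# , trans (frob-zero z) (sym (*-identityˡ z))

      fixes-v : Fixes v z
      fixes-v = 1# , InFq*-1# , trans (frob-v z) (sym (*-identityˡ z))

      fixes-+ : ∀ {i j} → Fixes i z → Fixes j z → Fixes (i ℕ.+ j) z
      fixes-+ {i} {j} (a , a∈ , φⁱz≈az) (b , b∈ , φʲz≈bz) = a * b , InFq*-* a∈ b∈ , (begin
        frob (i ℕ.+ j) z    ≈⟨ frob-∘ j i z ⟨
        frob j (frob i z)   ≈⟨ frob-cong j φⁱz≈az ⟩
        frob j (a * z)      ≈⟨ frob-* j a z ⟩
        frob j a * frob j z ≈⟨ *-cong (frob-InFq j (proj₁ a∈)) φʲz≈bz ⟩
        a * (b * z)         ≈⟨ *-assoc _ _ _ ⟨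
        (a * b) * z         ∎)
        where open ≈-Reasoning

      fixes-* : ∀ {i} k → Fixes i z → Fixes (k ℕ.* i) z
      fixes-* zero _ = fixes-0
      fixes-* {i} (suc k) fixes-i = fixes-+ {i} {k ℕ.* i} fixes-i (fixes-* k fixes-i)

      fixes-∸ : ∀ {i j} → Fixes i z → Fixes (i ℕ.+ j) z → Fixes j z
      fixes-∸ {i} {j} (a , a∈ , φⁱz≈az) (b , b∈ , φⁱ⁺ʲz≈bz) with InFq*-inverse a∈
      ... | a⁻¹ , a⁻¹∈ , aa⁻¹≈1 = a⁻¹ * b , InFq*-* a⁻¹∈ b∈ , *-cancelˡ (proj₂ a∈) (begin
        a * frob j z            ≈⟨ *-congʳ (frob-InFq j (proj₁ a∈)) ⟨
        frob j a * frob j z     ≈⟨ frob-* j a z ⟨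
        frob j (a * z)          ≈⟨ frob-cong j φⁱz≈az ⟨
        frob j (frob i z)       ≈⟨ frob-∘ j i z ⟩
        frob (i ℕ.+ j) z        ≈⟨ φⁱ⁺ʲz≈bz ⟩
        b * z                   ≈⟨ *-identityˡ _ ⟨
        1# * (b * z)            ≈⟨ *-congʳ aa⁻¹≈1 ⟨
        (a * a⁻¹) * (b * z)     ≈⟨ solve 4 (λ a a⁻¹ b z → (a :* a⁻¹) :* (b :* z) := a :* ((a⁻¹ :* b) :* z)) refl a a⁻¹ b z ⟩
        a * ((a⁻¹ * b) * z)     ∎)
        where open ≈-Reasoning

      -- v is prime, so gcd(e, v) = 1 and a Bézout combination of e and v yields 1.
      fixes-1 : ∀ {e} → 0 < e → e < v → Fixes e z → Fixes 1 z
      fixes-1 {e} 0<e e<v fixes-e with coprime-Bézout v⊥e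
        where
        v⊥e : Coprime v e
        v⊥e {d} (d∣v , d∣e) with prime⇒irreducible v-prime d∣v
        ... | inj₁ d≡1 = d≡1
        ... | inj₂ ≡.refl = ⊥-elim (ℕ.<⇒≱ e<v (∣⇒≤ {{ℕ.>-nonZero 0<e}} d∣e))
      ... | Bézout.+- x y eq = fixes-∸ {y ℕ.* e} {1} (fixes-* {e} y fixes-e)
              (≡.subst (λ n → Fixes n z) (ℕ.+-comm 1 (y ℕ.* e)) (≡.subst (λ n → Fixes n z) (≡.sym eq) (fixes-* {v} x fixes-v)))
      ... | Bézout.-+ x y eq = fixes-∸ {x ℕ.* v} {1} (fixes-* {v} x fixes-v)
              (≡.subst (λ n → Fixes n z) (ℕ.+-comm 1 (x ℕ.* v)) (≡.subst (λ n → Fixes n z) (≡.sym eq) (fixes-* {e} y fixes-e)))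

    pow≈1-Bézout : ∀ {b} A B → pow b A ≈ 1# → pow b B ≈ 1# → Bézout.Identity 1 A B → b ≈ 1#
    pow≈1-Bézout {b} A B bᴬ≈1 bᴮ≈1 (Bézout.+- x y eq) = begin
      b                       ≈⟨ *-identityʳ b ⟨
      b * 1#                  ≈⟨ *-congˡ (trans (pow-cong y bᴮ≈1) (pow-1# y)) ⟨
      b * pow (pow b B) y     ≈⟨ *-congˡ (pow-*-assoc b B y) ⟨
      pow b (1 ℕ.+ B ℕ.* y)   ≡⟨ ≡.cong (λ n → pow b (1 ℕ.+ n)) (ℕ.*-comm B y) ⟩
      pow b (1 ℕ.+ y ℕ.* B)   ≡⟨ ≡.cong (pow b) eq ⟩
      pow b (x ℕ.* A)         ≡⟨ ≡.cong (pow b) (ℕ.*-comm x A) ⟩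
      pow b (A ℕ.* x)         ≈⟨ pow-*-assoc b A x ⟩
      pow (pow b A) x         ≈⟨ trans (pow-cong x bᴬ≈1) (pow-1# x) ⟩
      1#                      ∎
      where open ≈-Reasoning
    pow≈1-Bézout A B bᴬ≈1 bᴮ≈1 (Bézout.-+ x y eq) = pow≈1-Bézout B A bᴮ≈1 bᴬ≈1 (Bézout.+- y x eq)

    frob-eigenvector : ∀ {z b} → InFq b → frob 1 z ≈ b * z → ∀ n → frob n z ≈ pow b n * z
    frob-eigenvector {z} {b} b∈ φz≈bz zero = trans (frob-zero z) (sym (*-identityˡ z))
    frob-eigenvector {z} {b} b∈ φz≈bz (suc n) = begin
      frob (suc n) z             ≡⟨ ≡.cong (λ k → frob k z) (ℕ.+-comm 1 n) ⟩
      frob (n ℕ.+ 1) z           ≈⟨ frob-∘ 1 n z ⟨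
      frob 1 (frob n z)          ≈⟨ frob-cong 1 (frob-eigenvector b∈ φz≈bz n) ⟩
      frob 1 (pow b n * z)       ≈⟨ frob-* 1 _ z ⟩
      frob 1 (pow b n) * frob 1 z ≈⟨ *-cong (frob-InFq 1 (trans (sym (pow-comm b q n)) (pow-cong n b∈))) φz≈bz ⟩
      pow b n * (b * z)          ≈⟨ solve 3 (λ a b z → a :* (b :* z) := (b :* a) :* z) refl _ b z ⟩
      (b * pow b n) * z          ∎
      where open ≈-Reasoning

    -- If φ^e fixes [z] for some 0 < e < v then φ z = b z with b^v = b^(q-1) = 1, so b = 1 and z ∈ F_q.
    not-fixed : ∀ {z} → NonIdentity z → ∀ {e} → 0 < e → e < v → ¬ Fixes e z
    not-fixed {z} (z≉0 , z∉Fq) 0<e e<v fixes-e with fixes-1 0<e e<v fixes-e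
    ... | b , (b∈ , b≉0) , φz≈bz = z∉Fq (trans (sym (frob-one z)) (trans φz≈bz (trans (*-congʳ b≈1) (*-identityˡ z))))
      where
      bᵛ≈1 : pow b v ≈ 1#
      bᵛ≈1 = *-cancelˡ z≉0 (trans (*-comm z _) (trans (sym (frob-eigenvector b∈ φz≈bz v)) (trans (frob-v z) (sym (*-identityʳ z)))))
      bᵠ⁻¹≈1 : pow b (suc q′) ≈ 1#
      bᵠ⁻¹≈1 = *-cancelˡ b≉0 (trans b∈ (sym (*-identityʳ b)))
      v⊥q-1 : Coprime v (suc q′)
      v⊥q-1 {d} (d∣v , d∣q-1) with prime⇒irreducible v-prime d∣v
      ... | inj₁ d≡1 = d≡1
      ... | inj₂ ≡.refl = ⊥-elim (v∤q-1 d∣q-1)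
      b≈1 : b ≈ 1#
      b≈1 = pow≈1-Bézout v (suc q′) bᵛ≈1 bᵠ⁻¹≈1 (coprime-Bézout v⊥q-1)

    frob-orbit-distinct : ∀ {z} → NonIdentity z → ∀ {i j} → i < j → j < v → ¬ (frob i z ∼ frob j z)
    frob-orbit-distinct {z} z≠1 {i} {j} i<j j<v φⁱz∼φʲz with ∼⇒scalar φⁱz∼φʲz
    ... | a , a∈ , φⁱz≈aφʲz = not-fixed z≠1 0<e e<v (a , a∈ , (begin
      frob (i ℕ.+ (v ℕ.∸ j)) z              ≈⟨ frob-∘ (v ℕ.∸ j) i z ⟨
      frob (v ℕ.∸ j) (frob i z)             ≈⟨ frob-cong (v ℕ.∸ j) φⁱz≈aφʲz ⟩
      frob (v ℕ.∸ j) (a * frob j z)         ≈⟨ frob-* (v ℕ.∸ j) a _ ⟩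
      frob (v ℕ.∸ j) a * frob (v ℕ.∸ j) (frob j z) ≈⟨ *-cong (frob-InFq (v ℕ.∸ j) (proj₁ a∈)) (frob-∘ (v ℕ.∸ j) j z) ⟩
      a * frob (j ℕ.+ (v ℕ.∸ j)) z           ≡⟨ ≡.cong (λ n → a * frob n z) (ℕ.m+[n∸m]≡n (ℕ.<⇒≤ j<v)) ⟩
      a * frob v z                          ≈⟨ *-congˡ (frob-v z) ⟩
      a * z                                 ∎))
      where
      open ≈-Reasoning
      e = i ℕ.+ (v ℕ.∸ j)
      0<e : 0 < e
      0<e = ℕ.<-≤-trans (ℕ.m<n⇒0<n∸m j<v) (ℕ.m≤n+m _ i)
      e<v : e < v
      e<v = ℕ.<-≤-trans (ℕ.+-monoˡ-< (v ℕ.∸ j) i<j) (ℕ.≤-reflexive (ℕ.m+[n∸m]≡n (ℕ.<⇒≤ j<v)))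

    -- The points [φⁱ z], i < v, are distinct, so membership of [x y⁻¹] in the orbit splits into v disjoint cases.
    orbitCount≡∑diffCount : ∀ {k} (B : Vec Carrier k) z → orbitCount v B z ≡ ∑[ i ∈ upTo v ] diffCount B (frob i z)
    orbitCount≡∑diffCount B z with NonIdentity? z
    ... | no z≡1 = ≡.trans (orbitCount-identity B z≡1)
                     (≡.sym (≡.trans (∑-cong (upTo v) (λ i → diffCount-identity B (frob-¬NonIdentity i z≡1))) (∑-0 (upTo v))))
    ... | yes z≠1 = begin
      orbitCount v B z                                                              ≡⟨ orbitCount≡∑∑ B z ⟩
      ∑[ x ∈ span B ] ∑[ y ∈ span B ] 𝟙 (orbit? z x y)                               ≡⟨ ∑-cong (span B) (λ x → ∑-cong (span B) (split x)) ⟩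
      ∑[ x ∈ span B ] ∑[ y ∈ span B ] ∑[ i ∈ upTo v ] 𝟙 (differences? (frob i z) x y) ≡⟨ ∑-cong (span B) (λ x → ∑-comm (span B) (upTo v) _) ⟩
      ∑[ x ∈ span B ] ∑[ i ∈ upTo v ] ∑[ y ∈ span B ] 𝟙 (differences? (frob i z) x y) ≡⟨ ∑-comm (span B) (upTo v) _ ⟩
      ∑[ i ∈ upTo v ] ∑[ x ∈ span B ] ∑[ y ∈ span B ] 𝟙 (differences? (frob i z) x y) ≡⟨ ∑-cong (upTo v) (λ i → diffCount≡∑∑ B (frob i z)) ⟨
      ∑[ i ∈ upTo v ] diffCount B (frob i z)                                        ∎
      where
      open ≡.≡-Reasoning
      split : ∀ x y → 𝟙 (orbit? z x y) ≡ ∑[ i ∈ upTo v ] 𝟙 (differences? (frob i z) x y)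
      split x y with PairOK? (x , y)
      ... | no _ = ≡.sym (∑-0 (upTo v))
      ... | yes ok@(_ , y≉0 , _) = begin
        𝟙 (yes ok ×-dec any? (λ i → x ∼? (frob i z * y)) (upTo v))  ≡⟨ 𝟙-× (yes ok) _ ⟩
        1 ℕ.* 𝟙 (any? (λ i → x ∼? (frob i z * y)) (upTo v))         ≡⟨ ℕ.*-identityˡ _ ⟩
        𝟙 (any? (λ i → x ∼? (frob i z * y)) (upTo v))               ≡⟨ 𝟙-any (λ i → x ∼? (frob i z * y)) (AllPairs.applyUpTo⁺₁ (λ i → i) v distinct) ⟩
        ∑[ i ∈ upTo v ] 𝟙 (x ∼? (frob i z * y))                     ≡⟨ ∑-cong (upTo v) (λ i → ≡.trans (𝟙-× (yes ok) _) (ℕ.*-identityˡ _)) ⟨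
        ∑[ i ∈ upTo v ] 𝟙 (yes ok ×-dec (x ∼? (frob i z * y)))       ∎
        where
        distinct : ∀ {i j} → i < j → j < v → x ∼ (frob i z * y) → x ∼ (frob j z * y) → ⊥
        distinct i<j j<v x∼φⁱzy x∼φʲzy = frob-orbit-distinct z≠1 i<j j<v (∼-*-cancelʳ y≉0 (∼-trans (∼-sym x∼φⁱzy) x∼φʲzy))

    ∑-diffCount-frob : ∀ {k} (B : Vec Carrier k) z → ∑[ i ∈ upTo v ] diffCount (Vec.map (frob i) B) z ≡ orbitCount v B z
    ∑-diffCount-frob B z = begin
      ∑[ i ∈ upTo v ] diffCount (Vec.map (frob i) B) z  ≡⟨ ∑-cong-All (All.map (λ i<v → diffCount-frob B (ℕ.<⇒≤ i<v) z) (All.all-upTo v)) ⟩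
      ∑[ i ∈ upTo v ] diffCount B (frob (v ℕ.∸ i) z)    ≡⟨ ∑-upTo _ v ⟩
      ∑[ i < v ] diffCount B (frob (v ℕ.∸ i) z)         ≡⟨ ∑<-reflect v (λ n → diffCount B (frob n z)) (diffCount-resp-≈ B (trans (frob-v z) (sym (frob-zero z)))) ⟩
      ∑[ i < v ] diffCount B (frob i z)                 ≡⟨ ∑-upTo _ v ⟨
      ∑[ i ∈ upTo v ] diffCount B (frob i z)            ≡⟨ orbitCount≡∑diffCount B z ⟨
      orbitCount v B z                                  ∎
      where open ≡.≡-Reasoning

    ∑-orbitCount : ∀ {k} {B : Vec Carrier k} → LinIndep B →
                   ∑[ z ∈ elems ] orbitCount v B z ≡ v ℕ.* (suc q′ ℕ.* ((q ^ k ℕ.∸ 1) ℕ.* ((q ^ k ℕ.∸ 1) ℕ.∸ suc q′)))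
    ∑-orbitCount {k} {B} independent = begin
      ∑[ z ∈ elems ] orbitCount v B z                            ≡⟨ ∑-cong elems (orbitCount≡∑diffCount B) ⟩
      ∑[ z ∈ elems ] ∑[ i ∈ upTo v ] diffCount B (frob i z)      ≡⟨ ∑-comm elems (upTo v) _ ⟩
      ∑[ i ∈ upTo v ] ∑[ z ∈ elems ] diffCount B (frob i z)      ≡⟨ ∑-cong-All (All.map (λ i<v → ∑-frob (ℕ.<⇒≤ i<v) (diffCount B) (diffCount-resp-≈ B)) (All.all-upTo v)) ⟩
      ∑[ i ∈ upTo v ] ∑[ z ∈ elems ] diffCount B z               ≡⟨ ∑-cong (upTo v) (λ _ → ∑-diffCount) ⟩
      ∑[ i ∈ upTo v ] (suc q′ ℕ.* #pairs)                        ≡⟨ ∑-const (upTo v) _ ⟩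
      length (upTo v) ℕ.* (suc q′ ℕ.* #pairs)                    ≡⟨ ≡.cong₂ (λ n m → n ℕ.* (suc q′ ℕ.* m)) (List.length-upTo v) #pairs≡ ⟩
      v ℕ.* (suc q′ ℕ.* ((q ^ k ℕ.∸ 1) ℕ.* ((q ^ k ℕ.∸ 1) ℕ.∸ suc q′))) ∎
      where
      open ≡.≡-Reasoning
      open Block B independent

    frobFamily-LinIndep : ∀ {k} {I : List (Vec Carrier k)} → All LinIndep I → All LinIndep (frobFamily v I)
    frobFamily-LinIndep [] = []
    frobFamily-LinIndep (independent ∷ independents) =
      All.++⁺ (All.map⁺ (All.universal (λ i → frob-LinIndep i independent) (upTo v))) (frobFamily-LinIndep independents)

    ∑-frobFamily : ∀ {k} (I : List (Vec Carrier k)) z → ∑[ B ∈ frobFamily v I ] diffCount B z ≡ ∑[ B ∈ I ] orbitCount v B z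
    ∑-frobFamily I z = ≡.trans (∑-concatMap _ I _)
      (∑-cong I (λ B → ≡.trans (∑-map _ (upTo v) (λ B′ → diffCount B′ z)) (∑-diffCount-frob B z)))

    -- Summing the orbit counts over all z: by even distribution the non-identity z contribute equally
    -- and the others nothing; by ∑-orbitCount each block contributes v (q - 1) (q^k - 1)(q^k - q).
    evenly-distributed-count : ∀ {k} {I : List (Vec Carrier k)} → All LinIndep I → EvenlyDistributed v I →
      ∀ {z} → NonIdentity z →
      (∑[ B ∈ I ] orbitCount v B z) ℕ.* length (filter NonIdentity? elems)
        ≡ length I ℕ.* (v ℕ.* (suc q′ ℕ.* ((q ^ k ℕ.∸ 1) ℕ.* ((q ^ k ℕ.∸ 1) ℕ.∸ suc q′))))
    evenly-distributed-count {k} {I} independents evenly {z} z≠1 = begin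
      c-z ℕ.* length (filter NonIdentity? elems)                  ≡⟨ ≡.cong (c-z ℕ.*_) (length-filter≡∑𝟙 NonIdentity? elems) ⟩
      c-z ℕ.* ∑[ z′ ∈ elems ] 𝟙 (NonIdentity? z′)                 ≡⟨ ∑-*ˡ elems c-z _ ⟨
      ∑[ z′ ∈ elems ] (c-z ℕ.* 𝟙 (NonIdentity? z′))               ≡⟨ ∑-cong elems (λ z′ → ≡.sym (orbits-of z′ (NonIdentity? z′))) ⟩
      ∑[ z′ ∈ elems ] ∑[ B ∈ I ] orbitCount v B z′              ≡⟨ ∑-comm elems I _ ⟩
      ∑[ B ∈ I ] ∑[ z′ ∈ elems ] orbitCount v B z′              ≡⟨ ∑-cong-All (All.map ∑-orbitCount independents) ⟩
      ∑[ B ∈ I ] (v ℕ.* (suc q′ ℕ.* ((q ^ k ℕ.∸ 1) ℕ.* ((q ^ k ℕ.∸ 1) ℕ.∸ suc q′)))) ≡⟨ ∑-const I _ ⟩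
      length I ℕ.* (v ℕ.* (suc q′ ℕ.* ((q ^ k ℕ.∸ 1) ℕ.* ((q ^ k ℕ.∸ 1) ℕ.∸ suc q′)))) ∎
      where
      open ≡.≡-Reasoning
      c-z = ∑[ B ∈ I ] orbitCount v B z
      orbits-of : ∀ z′ (z′≠1? : Dec (NonIdentity z′)) → ∑[ B ∈ I ] orbitCount v B z′ ≡ c-z ℕ.* 𝟙 z′≠1?
      orbits-of z′ (yes z′≠1) = ≡.trans (evenly z′ z z′≠1 z≠1) (≡.sym (ℕ.*-identityʳ c-z))
      orbits-of z′ (no z′≡1) = ≡.trans (∑-cong-All (All.map (λ {B} _ → orbitCount-identity B z′≡1) independents))
                                       (≡.trans (∑-0 I) (≡.sym (ℕ.*-zeroʳ c-z)))

module GaussianNumbers where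

  open import Defs using ([_]_)
  open import Data.Nat using (zero; suc; _+_; _*_; _∸_; _^_; _<_; s≤s; z≤n; >-nonZero)
  open import Data.Nat.Properties using (+-cancelʳ-≡; m+n∸n≡m; *-cancelʳ-≡)
  open import Relation.Binary.PropositionalEquality using (_≡_; refl; cong; sym; trans; module ≡-Reasoning)
  open import Data.Nat.Solver using (module +-*-Solver)
  open +-*-Solver using (solve; _:+_; _:*_; _:=_; con)

  geometric-sum : ∀ r n → [ n ] (suc r) * r + 1 ≡ suc r ^ n
  geometric-sum r zero = refl
  geometric-sum r (suc n) = begin
    (1 + suc r * [ n ] (suc r)) * r + 1 ≡⟨ solve 2 (λ r G → (con 1 :+ (con 1 :+ r) :* G) :* r :+ con 1 := (con 1 :+ r) :* (G :* r :+ con 1)) refl r ([ n ] (suc r)) ⟩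
    suc r * ([ n ] (suc r) * r + 1)     ≡⟨ cong (suc r *_) (geometric-sum r n) ⟩
    suc r * suc r ^ n                   ∎
    where open ≡-Reasoning

  -- Here q = q′ + 2, v = v″ + 2 and k = k₀ + 1; N stands for q^v - q, the number of non-identity elements,
  -- and (q^k - 1)(q^k - q) is the number of pairs of non-proportional nonzero vectors of F_q^k.
  count-per-difference : ∀ q′ v″ k₀ u c N → let q = suc (suc q′); v = suc (suc v″) in
    N + q ≡ q ^ v →
    [ suc v″ ] q ≡ (u * v) * ([ suc k₀ ] q * [ k₀ ] q) →
    c * N ≡ u * (v * (suc q′ * ((q ^ suc k₀ ∸ 1) * ((q ^ suc k₀ ∸ 1) ∸ suc q′)))) →
    c ≡ suc q′ * suc q′
  count-per-difference q′ v″ k₀ u c N N+q≡qᵛ [v-1]≡ c*N≡ = *-cancelʳ-≡ c (r * r) N {{>-nonZero N>0}} (begin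
    c * N                                                       ≡⟨ c*N≡ ⟩
    u * (v * (r * ((q ^ suc k₀ ∸ 1) * ((q ^ suc k₀ ∸ 1) ∸ r)))) ≡⟨ cong (λ t → u * (v * (r * (t * (t ∸ r))))) qᵏ-1≡ ⟩
    u * (v * (r * (((1 + q * a) * r) * ((1 + q * a) * r ∸ r)))) ≡⟨ cong (λ t → u * (v * (r * (((1 + q * a) * r) * t)))) qᵏ-q≡ ⟩
    u * (v * (r * (((1 + q * a) * r) * (q * a * r))))           ≡⟨ solve 5 (λ u v r q a → u :* (v :* (r :* (((con 1 :+ q :* a) :* r) :* (q :* a :* r)))) := r :* r :* (q :* ((u :* v) :* ((con 1 :+ q :* a) :* a)) :* r)) refl u v r q a ⟩
    r * r * (q * ((u * v) * ((1 + q * a) * a)) * r)            ≡⟨ cong (λ t → r * r * (q * t * r)) (sym [v-1]≡) ⟩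
    r * r * (q * A * r)                                         ≡⟨ cong (r * r *_) (sym N≡) ⟩
    r * r * N                                                   ∎)
    where
    open ≡-Reasoning
    q = suc (suc q′)
    r = suc q′
    v = suc (suc v″)
    A = [ suc v″ ] q
    a = [ k₀ ] q
    N≡ : N ≡ q * A * r
    N≡ = +-cancelʳ-≡ q N (q * A * r) (trans N+q≡qᵛ (trans (cong (q *_) (sym (geometric-sum r (suc v″))))
           (solve 3 (λ q A r → q :* (A :* r :+ con 1) := q :* A :* r :+ q) refl q A r)))
    N>0 : 0 < N
    N>0 rewrite N≡ = s≤s z≤n
    qᵏ-1≡ : q ^ suc k₀ ∸ 1 ≡ (1 + q * a) * r
    qᵏ-1≡ = trans (cong (_∸ 1) (sym (geometric-sum r (suc k₀)))) (m+n∸n≡m _ 1)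
    qᵏ-q≡ : (1 + q * a) * r ∸ r ≡ q * a * r
    qᵏ-q≡ = trans (cong (_∸ r) (solve 3 (λ q a r → (con 1 :+ q :* a) :* r := q :* a :* r :+ r) refl q a r)) (m+n∸n≡m _ r)

open import Data.Nat using (_*_; _∸_; _^_; _≤_; _≥_; s≤s; nonTrivial⇒n>1)
open import Data.Nat.Properties using (≤-trans; ≤-reflexive; *-identityʳ; ^-monoʳ-≤)
open import Data.Nat.Divisibility using (_∣_)
open import Data.Nat.Primality using (prime⇒nonTrivial; prime⇒nonZero)
open import Data.Product using (_,_)
open import Data.List using (length)
open import Data.List.Relation.Unary.All using (All)
open import Data.List.Relation.Unary.AllPairs using (AllPairs)
open import Data.Vec using (Vec)
open import Relation.Binary.PropositionalEquality using (refl; sym; trans; subst)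
open import Relation.Nullary using (¬_)
open GaussianNumbers using (count-per-difference)

prime-power≥2 : ∀ {p m q} → Prime p → m ≥ 1 → q ≡ p ^ m → 2 ≤ q
prime-power≥2 {p} {m} p-prime m≥1 refl =
  ≤-trans (nonTrivial⇒n>1 p {{prime⇒nonTrivial p-prime}}) (≤-trans (≤-reflexive (sym (*-identityʳ p))) (^-monoʳ-≤ p {{prime⇒nonZero p-prime}} m≥1))

theorem6p5 : ∀ {c ℓ} (R : CommutativeRing c ℓ)
    (_≟_ : Decidable (CommutativeRing._≈_ R)) →
    FF.IsField R _≟_ →
    (q p m : ℕ) → Prime p → m ≥ 1 → q ≡ p ^ m →
    (k v u : ℕ) → k ≥ 2 → Prime v → (k * (k ∸ 1)) ∣ (v ∸ 1) →
    [ v ∸ 1 ] q ≡ (u * v) * ([ k ] q * [ k ∸ 1 ] q) →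
    ¬ (v ∣ (q ∸ 1)) →
    (elems : List (CommutativeRing.Carrier R)) →
    FF.FiniteEnumeration R _≟_ elems (q ^ v) →
    (I : List (Vec (CommutativeRing.Carrier R) k)) →
    length I ≡ u →
    All (FF.WithEnum.LinIndep R _≟_ elems q) I →
    AllPairs (λ B B' → ¬ FF.WithEnum.SameSubspace R _≟_ elems q B B') I →
    FF.WithEnum.EvenlyDistributed R _≟_ elems q v I →
    FF.WithEnum.DifferenceFamily R _≟_ elems q (FF.WithEnum.frobFamily R _≟_ elems q v I)
theorem6p5 R _≟_ isField q p m p-prime m≥1 q≡pᵐ k v u (s≤s (s≤s {n = k″} _)) v-prime _ [v-1]≡ v∤q-1
           elems enumeration I length-I independents _ evenly
  with prime-power≥2 p-prime m≥1 q≡pᵐ | nonTrivial⇒n>1 v {{prime⇒nonTrivial v-prime}}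
... | s≤s (s≤s {n = q′} _) | s≤s (s≤s {n = v″} _) =
  frobFamily-LinIndep independents , λ z z≠1 →
    trans (∑-frobFamily I z) (count-per-difference q′ v″ (suc k″) u _ _ length-NonIdentity+q [v-1]≡
      (subst (λ n → _ ≡ n * _) length-I (evenly-distributed-count independents evenly z≠1)))
  where
  open GaloisField R _≟_ isField q′ p m p-prime q≡pᵐ (suc v″) elems enumeration using (length-NonIdentity+q; module Orbits)
  open Orbits v-prime v∤q-1 using (frobFamily-LinIndep; ∑-frobFamily; evenly-distributed-count)
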